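{- Let $\alpha=(\alpha_1,\ldots,\alpha_k)\in\mathbb{Z}_{\ge0}^k$ with $|\alpha|=\sum_i\alpha_i=n$, let $0\le m\le n$ and $p,q\in\mathbb{N}=\{0,1,2,\ldots\}$. Then $$\sum_{\substack{\beta\le\alpha\\ |\beta|=m}}\ \prod_{i=1}^k\binom{\alpha_i}{\beta_i}\,D_p(\omega^\beta)\,D_q(\omega^{\alpha-\beta})=\binom{n-p-q}{m-p}\,D_{p+q}(\omega^\alpha),$$ where $\beta\le\alpha$ means $\beta\in\mathbb{Z}_{\ge0}^k$ with $\beta_i\le\alpha_i$ for all $i$.
   Context: Here $\omega_1,\ldots,\omega_k$ are indeterminates, $\omega^\beta=\omega_1^{\beta_1}\cdots\omega_k^{\beta_k}$, $|\beta|=\sum_i\beta_i$. The total differential operators $D_j$ on $\mathbb{Q}[\omega_1,\ldots,\omega_k]$ are defined by $D_0=\mathrm{id}$, $D_1=\sum_{i=1}^k\partial/\partial\omega_i$, and $D_j=D_1\circ D_{j-1}$. Binomial coefficients $\binom{a}{b}$ are taken to be $0$ when $b<0$ or $b>a$ (and the identity is trivially $0=0$ when $p+q>n$). -}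

module Defs where

open import Data.Nat as ℕ using (ℕ; zero; suc; _∸_; pred)
open import Data.Nat.Combinatorics using (_C_)
open import Data.Integer as ℤ using (ℤ; +_; -[1+_])
open import Data.Rational as ℚ using (ℚ; 0ℚ; 1ℚ)
open import Data.Fin using (Fin)
open import Data.Vec as Vec using (Vec; []; _∷_; lookup; updateAt; zipWith)
open import Data.Vec.Properties using (≡-dec)
open import Data.List as List using (List; []; _∷_; [_]; concatMap; filter; upTo; allFin; _++_)
open import Data.Product using (_×_; _,_)
open import Relation.Nullary using (yes; no)
open import Relation.Binary.PropositionalEquality using (_≡_)

-- Polynomials in ℚ[ω₁,…,ω_k], represented as formal finite sums of terms
-- c·ω^e (a list of (coefficient, exponent vector) pairs).

Mono : ℕ → Set
Mono k = Vec ℕ k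

Poly : ℕ → Set
Poly k = List (ℚ × Mono k)

coeff : ∀ {k} → Poly k → Mono k → ℚ
coeff [] e = 0ℚ
coeff ((c , f) ∷ P) e with ≡-dec ℕ._≟_ f e
... | yes _ = c ℚ.+ coeff P e
... | no  _ = coeff P e

_≈P_ : ∀ {k} → Poly k → Poly k → Set
P ≈P Q = ∀ e → coeff P e ≡ coeff Q e

infix 4 _≈P_

ℕtoℚ : ℕ → ℚ
ℕtoℚ n = (+ n) ℚ./ 1

mono : ∀ {k} → Mono k → Poly k
mono e = [ (1ℚ , e) ]

0P : ∀ {k} → Poly k
0P = []

_+P_ : ∀ {k} → Poly k → Poly k → Poly k
_+P_ = _++_

_*P_ : ∀ {k} → Poly k → Poly k → Poly k
P *P Q = concatMap (λ { (c , e) → List.map (λ { (d , f) → (c ℚ.* d , zipWith ℕ._+_ e f) }) Q }) P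

scaleP : ∀ {k} → ℚ → Poly k → Poly k
scaleP a P = List.map (λ { (c , e) → (a ℚ.* c , e) }) P

sumP : ∀ {k} → List (Poly k) → Poly k
sumP = List.foldr _+P_ 0P

-- ∂/∂ωᵢ on a term c·ω^e : gives (c·eᵢ)·ω^(e - εᵢ)  (coefficient 0 if eᵢ = 0)
∂term : ∀ {k} → Fin k → ℚ × Mono k → ℚ × Mono k
∂term i (c , e) = (c ℚ.* ℕtoℚ (lookup e i) , updateAt e i pred)

∂ : ∀ {k} → Fin k → Poly k → Poly k
∂ i P = List.map (∂term i) P

D₁ : ∀ {k} → Poly k → Poly k
D₁ {k} P = concatMap (λ i → ∂ i P) (allFin k)

D : ∀ {k} → ℕ → Poly k → Poly k
D zero    P = P
D (suc j) P = D₁ (D j P)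

below : ∀ {k} → Mono k → List (Mono k)
below [] = [ [] ]
below (a ∷ α) = concatMap (λ b → List.map (b ∷_) (below α)) (upTo (suc a))

∣_∣ : ∀ {k} → Mono k → ℕ
∣ β ∣ = Vec.sum β

belowOfSize : ∀ {k} → Mono k → ℕ → List (Mono k)
belowOfSize α m = filter (λ β → ℕ._≟_ ∣ β ∣ m) (below α)

multiBinom : ∀ {k} → Mono k → Mono k → ℕ
multiBinom α β = Vec.foldr _ ℕ._*_ 1 (zipWith _C_ α β)

-- binomial coefficient with integer arguments, 0 when b < 0 or b > a
-- (in particular 0 when a < 0)
binomℤ : ℤ → ℤ → ℕ
binomℤ (+ a)    (+ b)    = a C b
binomℤ (+ a)    -[1+ b ] = 0
binomℤ -[1+ a ] _        = 0

LHS : ∀ {k} → Mono k → ℕ → ℕ → ℕ → Poly k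
LHS α m p q =
  sumP (List.map (λ β → scaleP (ℕtoℚ (multiBinom α β))
                                (D p (mono β) *P D q (mono (zipWith _∸_ α β))))
                 (belowOfSize α m))

RHS : ∀ {k} → Mono k → ℕ → ℕ → ℕ → ℕ → Poly k
RHS α n m p q =
  scaleP (ℕtoℚ (binomℤ ((+ n) ℤ.- (+ p) ℤ.- (+ q)) ((+ m) ℤ.- (+ p))))
         (D (p ℕ.+ q) (mono α))

-- Compare coefficients. Since D₁ = Σᵢ ∂/∂ωᵢ, the coefficient of ω^e in D_p(ω^β) is
-- p! ∏ᵢ C(βᵢ, eᵢ) if |e| + p = |β| and 0 otherwise, and the coefficients of a product are
-- the convolution over f ≤ e. At ω^e the left-hand side thus becomes p! q! times a sum,
-- over β ≤ α with |β| = m and f ≤ e with |f| = m − p, of C(α,β) C(β,f) C(α−β, e−f).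
-- Binomial revision turns the summand into C(α,e) C(e,f) C(α−e, β−f); a multi-index
-- Vandermonde convolution over β then gives C(|α−e|, p) = C(p+q, p), and one over f gives
-- C(|e|, m−p) = C(n−p−q, m−p). As p! q! C(p+q, p) = (p+q)!, this is the coefficient of ω^e
-- on the right-hand side.
module Submission where

open import Defs
open import Algebra.Bundles using (CommutativeSemiring; CommutativeRing)
open import Data.Bool using (true; false; if_then_else_; T; _∧_)
open import Data.Empty using (⊥-elim)
open import Data.Fin using (Fin) renaming (zero to fzero; suc to fsuc)
open import Data.List as List using (List; []; _∷_; [_]; _++_; concatMap; tabulate; applyUpTo; upTo; allFin; filter)
open import Data.Nat using (ℕ; zero; suc; _≤_; _<_; z≤n; s≤s)
open import Data.Product using (_×_; _,_)
open import Data.Vec as Vec using (Vec; []; _∷_; zipWith; lookup; updateAt)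
open import Data.Vec.Relation.Binary.Pointwise.Inductive using (Pointwise; []; _∷_)
open import Data.Vec.Properties using (≡-dec)
open import Function using (_∘_)
open import Relation.Binary.PropositionalEquality using (_≡_; refl; cong; module ≡-Reasoning)
open import Relation.Nullary using (yes; no; does)

module Sums {c ℓ} (R : CommutativeSemiring c ℓ) where

  open CommutativeSemiring R renaming (refl to ≈-refl; sym to ≈-sym; trans to ≈-trans)
  open import Algebra.Properties.Semiring.Sum semiring public using (sum; sum-cong-≗; *-distribˡ-sum)
  open import Relation.Binary.Reasoning.Setoid setoid

  open import Algebra.Properties.CommutativeSemigroup +-commutativeSemigroup using (interchange)

  private variable A B : Set

  ∑ : List A → (A → Carrier) → Carrier
  ∑ []       g = 0#
  ∑ (x ∷ xs) g = g x + ∑ xs g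

  syntax ∑ xs (λ x → g) = ∑[ x ∈ xs ] g

  ∑-cong : ∀ (xs : List A) {g h} → (∀ x → g x ≈ h x) → ∑ xs g ≈ ∑ xs h
  ∑-cong []       g≈h = ≈-refl
  ∑-cong (x ∷ xs) g≈h = +-cong (g≈h x) (∑-cong xs g≈h)

  ∑-zero : ∀ (xs : List A) {g} → (∀ x → g x ≈ 0#) → ∑ xs g ≈ 0#
  ∑-zero []       g≈0 = ≈-refl
  ∑-zero (x ∷ xs) g≈0 = ≈-trans (+-cong (g≈0 x) (∑-zero xs g≈0)) (+-identityˡ 0#)

  ∑-++ : ∀ (xs ys : List A) g → ∑ (xs ++ ys) g ≈ ∑ xs g + ∑ ys g
  ∑-++ []       ys g = ≈-sym (+-identityˡ _)
  ∑-++ (x ∷ xs) ys g = ≈-trans (+-congˡ (∑-++ xs ys g)) (≈-sym (+-assoc _ _ _))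

  ∑-map : ∀ (f : A → B) xs g → ∑ (List.map f xs) g ≈ ∑ xs (g ∘ f)
  ∑-map f []       g = ≈-refl
  ∑-map f (x ∷ xs) g = +-congˡ (∑-map f xs g)

  ∑-concatMap : ∀ (f : A → List B) xs g → ∑ (concatMap f xs) g ≈ ∑[ x ∈ xs ] ∑ (f x) g
  ∑-concatMap f []       g = ≈-refl
  ∑-concatMap f (x ∷ xs) g = ≈-trans (∑-++ (f x) (concatMap f xs) g) (+-congˡ (∑-concatMap f xs g))

  ∑-distrib-+ : ∀ (xs : List A) g h → ∑[ x ∈ xs ] (g x + h x) ≈ ∑ xs g + ∑ xs h
  ∑-distrib-+ []       g h = ≈-sym (+-identityˡ 0#)
  ∑-distrib-+ (x ∷ xs) g h = ≈-trans (+-congˡ (∑-distrib-+ xs g h)) (interchange _ _ _ _)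

  *-distribˡ-∑ : ∀ a (xs : List A) g → a * ∑ xs g ≈ ∑[ x ∈ xs ] (a * g x)
  *-distribˡ-∑ a []       g = zeroʳ a
  *-distribˡ-∑ a (x ∷ xs) g = ≈-trans (distribˡ a (g x) _) (+-congˡ (*-distribˡ-∑ a xs g))

  ∑-comm : ∀ (xs : List A) (ys : List B) (g : A → B → Carrier) →
           ∑[ x ∈ xs ] ∑[ y ∈ ys ] g x y ≈ ∑[ y ∈ ys ] ∑[ x ∈ xs ] g x y
  ∑-comm []       ys g = ≈-sym (∑-zero ys (λ _ → ≈-refl))
  ∑-comm (x ∷ xs) ys g = ≈-trans (+-congˡ (∑-comm xs ys g)) (≈-sym (∑-distrib-+ ys (g x) _))

  ∑-tabulate : ∀ {n} (f : Fin n → A) g → ∑ (tabulate f) g ≈ sum (g ∘ f)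
  ∑-tabulate {n = zero}  f g = ≈-refl
  ∑-tabulate {n = suc n} f g = +-congˡ (∑-tabulate (f ∘ fsuc) g)

  ∑< : ℕ → (ℕ → Carrier) → Carrier
  ∑< zero    g = 0#
  ∑< (suc n) g = g 0 + ∑< n (g ∘ suc)

  syntax ∑< n (λ b → g) = ∑[ b < n ] g

  ∑<-cong : ∀ n {g h : ℕ → Carrier} → (∀ b → b < n → g b ≈ h b) → ∑< n g ≈ ∑< n h
  ∑<-cong zero    g≈h = ≈-refl
  ∑<-cong (suc n) g≈h = +-cong (g≈h 0 (s≤s z≤n)) (∑<-cong n (λ b b<n → g≈h (suc b) (s≤s b<n)))

  ∑<-init-last : ∀ n g → ∑< (suc n) g ≈ ∑< n g + g n
  ∑<-init-last zero    g = ≈-trans (+-identityʳ (g 0)) (≈-sym (+-identityˡ (g 0)))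
  ∑<-init-last (suc n) g = ≈-trans (+-congˡ (∑<-init-last n (g ∘ suc))) (≈-sym (+-assoc _ _ _))

  ∑<-zero : ∀ n {g : ℕ → Carrier} → (∀ b → g b ≈ 0#) → ∑< n g ≈ 0#
  ∑<-zero zero    g≈0 = ≈-refl
  ∑<-zero (suc n) g≈0 = ≈-trans (+-cong (g≈0 0) (∑<-zero n (g≈0 ∘ suc))) (+-identityˡ 0#)

  ∑<-distrib-+ : ∀ n g h → ∑[ b < n ] (g b + h b) ≈ ∑< n g + ∑< n h
  ∑<-distrib-+ zero    g h = ≈-sym (+-identityˡ 0#)
  ∑<-distrib-+ (suc n) g h = ≈-trans (+-congˡ (∑<-distrib-+ n (g ∘ suc) (h ∘ suc))) (interchange _ _ _ _)

  ∑-applyUpTo : ∀ (f : ℕ → A) n g → ∑ (applyUpTo f n) g ≈ ∑[ b < n ] g (f b)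
  ∑-applyUpTo f zero    g = ≈-refl
  ∑-applyUpTo f (suc n) g = +-congˡ (∑-applyUpTo (f ∘ suc) n g)

  ∑-below-∷ : ∀ {k} a (α : Vec ℕ k) g →
              ∑ (below (a ∷ α)) g ≈ ∑[ b < suc a ] ∑[ β ∈ below α ] g (b ∷ β)
  ∑-below-∷ a α g = begin
    ∑ (below (a ∷ α)) g
      ≈⟨ ∑-concatMap (λ b → List.map (b ∷_) (below α)) (upTo (suc a)) g ⟩
    ∑[ b ∈ upTo (suc a) ] ∑ (List.map (b ∷_) (below α)) g
      ≈⟨ ∑-applyUpTo (λ b → b) (suc a) _ ⟩
    ∑[ b < suc a ] ∑ (List.map (b ∷_) (below α)) g
      ≈⟨ ∑<-cong (suc a) (λ b _ → ∑-map (b ∷_) (below α) g) ⟩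
    ∑[ b < suc a ] ∑[ β ∈ below α ] g (b ∷ β) ∎

module Combinatorics where

  open import Data.Nat using (_+_; _*_; _∸_; _≡ᵇ_; _≟_; _≤?_; _!; NonZero)
  open import Data.Nat.Combinatorics using (_C_; nCk+nC[k+1]≡[n+1]C[k+1]; k>n⇒nCk≡0; nCn≡1; nC1≡n; nCk≡n!/k![n-k]!; k![n∸k]!∣n!)
  open import Data.Nat.DivMod using (m/n*n≡m)
  open import Data.Nat.Properties
  open import Data.List.Properties using (filter-accept; filter-reject)
  open import Data.Sum using (_⊎_; inj₁; inj₂)
  open import Relation.Nullary using (¬_)
  open import Data.Nat.Solver using (module +-*-Solver)
  open +-*-Solver using (solve; _:=_; _:+_; _:*_; con)
  open import Algebra.Properties.CommutativeSemigroup +-commutativeSemigroup as + using ()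
  open import Algebra.Properties.CommutativeSemigroup *-commutativeSemigroup as * using ()
  open import Relation.Binary.PropositionalEquality
  open Sums +-*-commutativeSemiring

  δ : ℕ → ℕ → ℕ
  δ x y = if x ≡ᵇ y then 1 else 0

  δ-elim : ∀ x y (P : ℕ → Set) → (x ≡ y → P 1) → (x ≢ y → P 0) → P (δ x y)
  δ-elim x y P p₁ p₀ with x ≡ᵇ y in eq
  ... | true  = p₁ (≡ᵇ⇒≡ x y (subst T (sym eq) _))
  ... | false = p₀ (λ x≡y → subst T eq (≡⇒≡ᵇ x y x≡y))

  δ-≡ : ∀ {x y} → x ≡ y → δ x y ≡ 1
  δ-≡ {x} {y} x≡y = δ-elim x y (_≡ 1) (λ _ → refl) (λ x≢y → ⊥-elim (x≢y x≡y))

  δ-≢ : ∀ {x y} → x ≢ y → δ x y ≡ 0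
  δ-≢ {x} {y} x≢y = δ-elim x y (_≡ 0) (λ x≡y → ⊥-elim (x≢y x≡y)) (λ _ → refl)

  δ-+ˡ : ∀ c x y → δ (c + x) (c + y) ≡ δ x y
  δ-+ˡ zero    x y = refl
  δ-+ˡ (suc c) x y = δ-+ˡ c x y

  δ-*-cong : ∀ x y {a b} → (x ≡ y → a ≡ b) → δ x y * a ≡ δ x y * b
  δ-*-cong x y {a} {b} a≡b = δ-elim x y (λ d → d * a ≡ d * b) (cong (1 *_) ∘ a≡b) (λ _ → refl)

  *-congˡ-unless-zero : ∀ {x y z} {P : Set} → x ≡ 0 ⊎ P → (P → y ≡ z) → x * y ≡ x * z
  *-congˡ-unless-zero         (inj₁ refl) _   = refl
  *-congˡ-unless-zero {x = x} (inj₂ p)    y≡z = cong (x *_) (y≡z p)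

  -- Binomial sums

  -- X C (y − z), but 0 (rather than X C 0) when y < z
  binom∸ : ℕ → ℕ → ℕ → ℕ
  binom∸ X y       zero    = X C y
  binom∸ X zero    (suc z) = 0
  binom∸ X (suc y) (suc z) = binom∸ X y z

  binom∸-pascal : ∀ X y z → binom∸ (suc X) y z ≡ binom∸ X y z + binom∸ X y (suc z)
  binom∸-pascal X zero    zero    = refl
  binom∸-pascal X (suc y) zero    = trans (sym (nCk+nC[k+1]≡[n+1]C[k+1] X y)) (+-comm (X C y) _)
  binom∸-pascal X zero    (suc z) = refl
  binom∸-pascal X (suc y) (suc z) = binom∸-pascal X y z

  binom∸-+ : ∀ X z y → binom∸ X (z + y) z ≡ X C y
  binom∸-+ X zero    y = refl
  binom∸-+ X (suc z) y = binom∸-+ X z y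

  binom∸-< : ∀ X {y z} → y < z → binom∸ X y z ≡ 0
  binom∸-< X {zero}  {suc z} _         = refl
  binom∸-< X {suc y} {suc z} (s≤s y<z) = binom∸-< X y<z

  binom∸-zero : ∀ y z → binom∸ 0 y z ≡ δ z y
  binom∸-zero zero    zero    = refl
  binom∸-zero (suc y) zero    = refl
  binom∸-zero zero    (suc z) = refl
  binom∸-zero (suc y) (suc z) = binom∸-zero y z

  ∑-binomial-extend : ∀ A d (g : ℕ → ℕ) → ∑[ b < suc (d + A) ] ((A C b) * g b) ≡ ∑[ b < suc A ] ((A C b) * g b)
  ∑-binomial-extend A zero    g = refl
  ∑-binomial-extend A (suc d) g = begin
    ∑[ b < suc (suc d + A) ] ((A C b) * g b)
      ≡⟨ ∑<-init-last (suc (d + A)) (λ b → (A C b) * g b) ⟩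
    ∑[ b < suc (d + A) ] ((A C b) * g b) + (A C suc (d + A)) * g (suc (d + A))
      ≡⟨ cong₂ _+_ (∑-binomial-extend A d g) (cong (_* g (suc (d + A))) (k>n⇒nCk≡0 (s≤s (m≤n+m A d)))) ⟩
    ∑[ b < suc A ] ((A C b) * g b) + 0
      ≡⟨ +-identityʳ _ ⟩
    ∑[ b < suc A ] ((A C b) * g b) ∎
    where open ≡-Reasoning

  ∑-binomial-pascal : ∀ A (g : ℕ → ℕ) → ∑[ b < suc (suc A) ] ((suc A C b) * g b)
                              ≡ ∑[ b < suc A ] ((A C b) * g b) + ∑[ b < suc A ] ((A C b) * g (suc b))
  ∑-binomial-pascal A g = begin
    1 * g 0 + ∑[ b < suc A ] ((suc A C suc b) * g (suc b))
      ≡⟨ cong (1 * g 0 +_) (∑<-cong (suc A) (λ b _ →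
           trans (cong (_* g (suc b)) (sym (nCk+nC[k+1]≡[n+1]C[k+1] A b))) (*-distribʳ-+ (g (suc b)) (A C b) _))) ⟩
    1 * g 0 + ∑[ b < suc A ] ((A C b) * g (suc b) + (A C suc b) * g (suc b))
      ≡⟨ cong (1 * g 0 +_) (∑<-distrib-+ (suc A) (λ b → (A C b) * g (suc b)) (λ b → (A C suc b) * g (suc b))) ⟩
    1 * g 0 + (∑[ b < suc A ] ((A C b) * g (suc b)) + ∑[ b < suc A ] ((A C suc b) * g (suc b)))
      ≡⟨ solve 3 (λ x y z → x :+ (y :+ z) := (x :+ z) :+ y) refl (1 * g 0) shifted extra ⟩
    ∑[ b < suc (suc A) ] ((A C b) * g b) + ∑[ b < suc A ] ((A C b) * g (suc b))
      ≡⟨ cong (_+ shifted) (∑-binomial-extend A 1 g) ⟩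
    ∑[ b < suc A ] ((A C b) * g b) + ∑[ b < suc A ] ((A C b) * g (suc b)) ∎
    where
    open ≡-Reasoning
    shifted = ∑[ b < suc A ] ((A C b) * g (suc b))
    extra = ∑[ b < suc A ] ((A C suc b) * g (suc b))

  vandermonde : ∀ A Y m u → ∑[ b < suc A ] ((A C b) * binom∸ Y m (u + b)) ≡ binom∸ (A + Y) m u
  vandermonde zero    Y m u = trans (+-identityʳ _) (trans (*-identityˡ _) (cong (binom∸ Y m) (+-identityʳ u)))
  vandermonde (suc A) Y m u = begin
    ∑[ b < suc (suc A) ] ((suc A C b) * binom∸ Y m (u + b))
      ≡⟨ ∑-binomial-pascal A (λ b → binom∸ Y m (u + b)) ⟩
    ∑[ b < suc A ] ((A C b) * binom∸ Y m (u + b)) + ∑[ b < suc A ] ((A C b) * binom∸ Y m (u + suc b))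
      ≡⟨ cong₂ _+_ (vandermonde A Y m u)
           (trans (∑<-cong (suc A) (λ b _ → cong (λ v → (A C b) * binom∸ Y m v) (+-suc u b))) (vandermonde A Y m (suc u))) ⟩
    binom∸ (A + Y) m u + binom∸ (A + Y) m (suc u)
      ≡⟨ binom∸-pascal (A + Y) m u ⟨
    binom∸ (suc A + Y) m u ∎
    where open ≡-Reasoning

  ∑-binom∸-shift : ∀ A f r (g : ℕ → ℕ) → ∑[ b < suc (f + r) ] (binom∸ A b f * g b) ≡ ∑[ b < suc r ] ((A C b) * g (f + b))
  ∑-binom∸-shift A zero    r g = refl
  ∑-binom∸-shift A (suc f) r g = ∑-binom∸-shift A f r (g ∘ suc)

  ∑-binom∸ : ∀ {A f a} → f + A ≤ a → ∀ (g : ℕ → ℕ) →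
             ∑[ b < suc a ] (binom∸ A b f * g b) ≡ ∑[ b < suc A ] ((A C b) * g (f + b))
  ∑-binom∸ {A} {f} f+A≤a g with m≤n⇒∃[o]m+o≡n f+A≤a
  ... | d , refl = begin
    ∑[ b < suc (f + A + d) ] (binom∸ A b f * g b)
      ≡⟨ cong (λ N → ∑[ b < suc N ] (binom∸ A b f * g b)) (trans (+-assoc f A d) (cong (f +_) (+-comm A d))) ⟩
    ∑[ b < suc (f + (d + A)) ] (binom∸ A b f * g b)
      ≡⟨ ∑-binom∸-shift A f (d + A) g ⟩
    ∑[ b < suc (d + A) ] ((A C b) * g (f + b))
      ≡⟨ ∑-binomial-extend A d (g ∘ (f +_)) ⟩
    ∑[ b < suc A ] ((A C b) * g (f + b)) ∎
    where open ≡-Reasoning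

  nCk*[k!*[n∸k]!]≡n! : ∀ {n k} → k ≤ n → (n C k) * (k ! * (n ∸ k) !) ≡ n !
  nCk*[k!*[n∸k]!]≡n! {n} {k} k≤n = trans (cong (_* (k ! * (n ∸ k) !)) (nCk≡n!/k![n-k]! k≤n)) (m/n*n≡m (k![n∸k]!∣n! k≤n))
    where instance _ = k !* (n ∸ k) !≢0

  [m+n]Cm*[m!*n!]≡[m+n]! : ∀ m n → ((m + n) C m) * (m ! * n !) ≡ (m + n) !
  [m+n]Cm*[m!*n!]≡[m+n]! m n = trans (cong (λ z → ((m + n) C m) * (m ! * z !)) (sym (m+n∸m≡n m n))) (nCk*[k!*[n∸k]!]≡n! (m≤m+n m n))

  -- the number of ways to pick disjoint subsets of sizes f, g and d from a set of size a
  trinomial : ℕ → ℕ → ℕ → ℕ → ℕ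
  trinomial a f g d = (a C (f + g)) * ((f + g) C f) * ((a ∸ (f + g)) C d)

  trinomial-factorial : ∀ a f g d → f + g + d ≤ a →
                        trinomial a f g d * (f ! * g ! * d ! * (a ∸ (f + g + d)) !) ≡ a !
  trinomial-factorial a f g d f+g+d≤a = begin
    trinomial a f g d * (f ! * g ! * d ! * (a ∸ (f + g + d)) !)
      ≡⟨ cong (λ z → trinomial a f g d * (f ! * g ! * d ! * z !)) (sym (∸-+-assoc a (f + g) d)) ⟩
    trinomial a f g d * (f ! * g ! * d ! * (a ∸ s ∸ d) !)
      ≡⟨ solve 7 (λ x₁ x₂ x₃ y₁ y₂ y₃ y₄ → x₁ :* x₂ :* x₃ :* (y₁ :* y₂ :* y₃ :* y₄)
                                          := x₁ :* ((x₂ :* (y₁ :* y₂)) :* (x₃ :* (y₃ :* y₄)))) refl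
           (a C s) (s C f) ((a ∸ s) C d) (f !) (g !) (d !) ((a ∸ s ∸ d) !) ⟩
    (a C s) * (((s C f) * (f ! * g !)) * (((a ∸ s) C d) * (d ! * (a ∸ s ∸ d) !)))
      ≡⟨ cong₂ (λ u v → (a C s) * (u * v)) ([m+n]Cm*[m!*n!]≡[m+n]! f g) (nCk*[k!*[n∸k]!]≡n! d≤a∸s) ⟩
    (a C s) * (s ! * (a ∸ s) !)
      ≡⟨ nCk*[k!*[n∸k]!]≡n! (≤-trans (m≤m+n s d) f+g+d≤a) ⟩
    a ! ∎
    where
    open ≡-Reasoning
    s = f + g
    d≤a∸s : d ≤ a ∸ s
    d≤a∸s = subst (_≤ a ∸ s) (m+n∸m≡n s d) (∸-monoˡ-≤ s f+g+d≤a)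

  trinomial-≰ : ∀ a f g d → ¬ (f + g + d ≤ a) → trinomial a f g d ≡ 0
  trinomial-≰ a f g d f+g+d≰a with f + g ≤? a
  ... | no  f+g≰a = cong (λ z → z * ((f + g) C f) * ((a ∸ (f + g)) C d)) (k>n⇒nCk≡0 (≰⇒> f+g≰a))
  ... | yes f+g≤a =
    trans (cong ((a C (f + g)) * ((f + g) C f) *_) (k>n⇒nCk≡0 a∸[f+g]<d)) (*-zeroʳ ((a C (f + g)) * ((f + g) C f)))
    where
    a∸[f+g]<d : a ∸ (f + g) < d
    a∸[f+g]<d = ≰⇒> (λ d≤ → f+g+d≰a (subst (f + g + d ≤_) (m+[n∸m]≡n f+g≤a) (+-monoʳ-≤ (f + g) d≤)))

  trinomial-comm : ∀ a f g d → trinomial a f g d ≡ trinomial a f d g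
  trinomial-comm a f g d with f + g + d ≤? a
  ... | no  f+g+d≰a =
    trans (trinomial-≰ a f g d f+g+d≰a) (sym (trinomial-≰ a f d g (f+g+d≰a ∘ subst (_≤ a) (+.xy∙z≈xz∙y f d g))))
  ... | yes f+g+d≤a = *-cancelʳ-≡ _ _ (f ! * g ! * d ! * (a ∸ (f + g + d)) !) (begin
    trinomial a f g d * (f ! * g ! * d ! * (a ∸ (f + g + d)) !)
      ≡⟨ trinomial-factorial a f g d f+g+d≤a ⟩
    a !
      ≡⟨ trinomial-factorial a f d g (subst (_≤ a) (+.xy∙z≈xz∙y f g d) f+g+d≤a) ⟨
    trinomial a f d g * (f ! * d ! * g ! * (a ∸ (f + d + g)) !)
      ≡⟨ cong (trinomial a f d g *_)
              (cong₂ _*_ (*.xy∙z≈xz∙y (f !) (d !) (g !)) (cong (λ z → (a ∸ z) !) (+.xy∙z≈xz∙y f d g))) ⟩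
    trinomial a f d g * (f ! * g ! * d ! * (a ∸ (f + g + d)) !) ∎)
    where
    open ≡-Reasoning
    instance
      _ : NonZero (f ! * g ! * d ! * (a ∸ (f + g + d)) !)
      _ = m*n≢0 _ _ {{m*n≢0 _ _ {{f !* g !≢0}} {{d !≢0}}}} {{(a ∸ (f + g + d)) !≢0}}

  binomial-revision : ∀ a b f d →
    (a C b) * (b C f) * ((a ∸ b) C d) ≡ (a C (f + d)) * ((f + d) C f) * binom∸ (a ∸ (f + d)) b f
  binomial-revision a b f d with f ≤? b
  ... | no  f≰b = begin
    (a C b) * (b C f) * ((a ∸ b) C d)
      ≡⟨ cong (λ z → (a C b) * z * ((a ∸ b) C d)) (k>n⇒nCk≡0 (≰⇒> f≰b)) ⟩
    (a C b) * 0 * ((a ∸ b) C d)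
      ≡⟨ cong (_* ((a ∸ b) C d)) (*-zeroʳ (a C b)) ⟩
    0
      ≡⟨ *-zeroʳ ((a C (f + d)) * ((f + d) C f)) ⟨
    (a C (f + d)) * ((f + d) C f) * 0
      ≡⟨ cong ((a C (f + d)) * ((f + d) C f) *_) (binom∸-< (a ∸ (f + d)) (≰⇒> f≰b)) ⟨
    (a C (f + d)) * ((f + d) C f) * binom∸ (a ∸ (f + d)) b f ∎
    where open ≡-Reasoning
  ... | yes f≤b with m≤n⇒∃[o]m+o≡n f≤b
  ...   | g , refl =
    trans (trinomial-comm a f g d) (cong ((a C (f + d)) * ((f + d) C f) *_) (sym (binom∸-+ (a ∸ (f + d)) f g)))

  -- Multi-indices

  _≤ᵛ_ : ∀ {k} → Vec ℕ k → Vec ℕ k → Set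
  _≤ᵛ_ = Pointwise _≤_

  infixl 6 _+ᵛ_ _∸ᵛ_

  _+ᵛ_ _∸ᵛ_ : ∀ {k} → Vec ℕ k → Vec ℕ k → Vec ℕ k
  _+ᵛ_ = zipWith _+_
  _∸ᵛ_ = zipWith _∸_

  ∣α∸β∣+∣β∣≡∣α∣ : ∀ {k} {α β : Vec ℕ k} → β ≤ᵛ α → ∣ α ∸ᵛ β ∣ + ∣ β ∣ ≡ ∣ α ∣
  ∣α∸β∣+∣β∣≡∣α∣                       []          = refl
  ∣α∸β∣+∣β∣≡∣α∣ {α = a ∷ α} {b ∷ β} (b≤a ∷ β≤α) = begin
    (a ∸ b + ∣ α ∸ᵛ β ∣) + (b + ∣ β ∣) ≡⟨ +.interchange (a ∸ b) _ b _ ⟩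
    (a ∸ b + b) + (∣ α ∸ᵛ β ∣ + ∣ β ∣) ≡⟨ cong₂ _+_ (m∸n+n≡m b≤a) (∣α∸β∣+∣β∣≡∣α∣ β≤α) ⟩
    a + ∣ α ∣                           ∎
    where open ≡-Reasoning

  ∣∣-mono-≤ᵛ : ∀ {k} {α β : Vec ℕ k} → β ≤ᵛ α → ∣ β ∣ ≤ ∣ α ∣
  ∣∣-mono-≤ᵛ {β = β} β≤α = subst (∣ β ∣ ≤_) (∣α∸β∣+∣β∣≡∣α∣ β≤α) (m≤n+m ∣ β ∣ _)

  ≤ᵛ∧∣∣≡⇒≡ : ∀ {k} {α β : Vec ℕ k} → β ≤ᵛ α → ∣ β ∣ ≡ ∣ α ∣ → β ≡ α
  ≤ᵛ∧∣∣≡⇒≡ []          _ = refl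
  ≤ᵛ∧∣∣≡⇒≡ {α = a ∷ α} {b ∷ β} (b≤a ∷ β≤α) sizes =
    cong₂ _∷_ b≡a (≤ᵛ∧∣∣≡⇒≡ β≤α (+-cancelˡ-≡ b _ _ (trans sizes (cong (_+ ∣ α ∣) (sym b≡a)))))
    where
    b≡a : b ≡ a
    b≡a = ≤-antisym b≤a (+-cancelʳ-≤ ∣ α ∣ a b (subst (_≤ b + ∣ α ∣) sizes (+-monoʳ-≤ b (∣∣-mono-≤ᵛ β≤α))))

  multiBinom≡0⊎≤ᵛ : ∀ {k} (α β : Vec ℕ k) → multiBinom α β ≡ 0 ⊎ β ≤ᵛ α
  multiBinom≡0⊎≤ᵛ []      []      = inj₂ []
  multiBinom≡0⊎≤ᵛ (a ∷ α) (b ∷ β) with b ≤? a | multiBinom≡0⊎≤ᵛ α β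
  ... | no  b≰a | _          = inj₁ (cong (_* multiBinom α β) (k>n⇒nCk≡0 (≰⇒> b≰a)))
  ... | yes _   | inj₁ vanish = inj₁ (trans (cong ((a C b) *_) vanish) (*-zeroʳ (a C b)))
  ... | yes b≤a | inj₂ β≤α   = inj₂ (b≤a ∷ β≤α)

  multiBinom-diag : ∀ {k} (α : Vec ℕ k) → multiBinom α α ≡ 1
  multiBinom-diag []      = refl
  multiBinom-diag (a ∷ α) = cong₂ _*_ (nCn≡1 a) (multiBinom-diag α)

  m+ᵛn≡o⇒m≤ᵛo : ∀ {k} {m n o : Vec ℕ k} → m +ᵛ n ≡ o → m ≤ᵛ o
  m+ᵛn≡o⇒m≤ᵛo {m = []}    {[]}    refl = []
  m+ᵛn≡o⇒m≤ᵛo {m = x ∷ m} {y ∷ n} refl = m≤m+n x y ∷ m+ᵛn≡o⇒m≤ᵛo refl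

  m+ᵛn≡o⇒n≡o∸ᵛm : ∀ {k} {m n o : Vec ℕ k} → m +ᵛ n ≡ o → n ≡ o ∸ᵛ m
  m+ᵛn≡o⇒n≡o∸ᵛm {m = []}    {[]}    refl = refl
  m+ᵛn≡o⇒n≡o∸ᵛm {m = x ∷ m} {y ∷ n} refl = cong₂ _∷_ (sym (m+n∸m≡n x y)) (m+ᵛn≡o⇒n≡o∸ᵛm refl)

  m+ᵛ[n∸ᵛm]≡n : ∀ {k} {m n : Vec ℕ k} → m ≤ᵛ n → m +ᵛ (n ∸ᵛ m) ≡ n
  m+ᵛ[n∸ᵛm]≡n []          = refl
  m+ᵛ[n∸ᵛm]≡n (x≤y ∷ m≤n) = cong₂ _∷_ (m+[n∸m]≡n x≤y) (m+ᵛ[n∸ᵛm]≡n m≤n)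

  ∑-below-cong : ∀ {k} (α : Vec ℕ k) {g h : Vec ℕ k → ℕ} → (∀ β → β ≤ᵛ α → g β ≡ h β) →
                 ∑ (below α) g ≡ ∑ (below α) h
  ∑-below-cong []      g≡h = cong (_+ 0) (g≡h [] [])
  ∑-below-cong (a ∷ α) {g} {h} g≡h = begin
    ∑ (below (a ∷ α)) g                          ≡⟨ ∑-below-∷ a α g ⟩
    ∑[ b < suc a ] ∑[ β ∈ below α ] g (b ∷ β)    ≡⟨ ∑<-cong (suc a) (λ b b≤a →
                                                      ∑-below-cong α (λ β β≤α → g≡h (b ∷ β) (≤-pred b≤a ∷ β≤α))) ⟩
    ∑[ b < suc a ] ∑[ β ∈ below α ] h (b ∷ β)    ≡⟨ ∑-below-∷ a α h ⟨
    ∑ (below (a ∷ α)) h                          ∎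
    where open ≡-Reasoning

  multiBinom∸ : ∀ {k} → Vec ℕ k → Vec ℕ k → Vec ℕ k → ℕ
  multiBinom∸ []      []      []      = 1
  multiBinom∸ (A ∷ As) (b ∷ β) (f ∷ fs) = binom∸ A b f * multiBinom∸ As β fs

  multiBinom-revision : ∀ {k} (α β : Vec ℕ k) {e f} → f ≤ᵛ e →
    multiBinom α β * (multiBinom β f * multiBinom (α ∸ᵛ β) (e ∸ᵛ f))
    ≡ multiBinom α e * (multiBinom e f * multiBinom∸ (α ∸ᵛ e) β f)
  multiBinom-revision []      []      []                = refl
  multiBinom-revision (a ∷ α) (b ∷ β) {e₀ ∷ e} {f₀ ∷ f} (f₀≤e₀ ∷ f≤e) with m≤n⇒∃[o]m+o≡n f₀≤e₀
  ... | d , refl = begin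
    ((a C b) * Mαβ) * (((b C f₀) * Mβf) * (((a ∸ b) C (f₀ + d ∸ f₀)) * Mα∸β))
      ≡⟨ cong (λ z → ((a C b) * Mαβ) * (((b C f₀) * Mβf) * (((a ∸ b) C z) * Mα∸β))) (m+n∸m≡n f₀ d) ⟩
    ((a C b) * Mαβ) * (((b C f₀) * Mβf) * (((a ∸ b) C d) * Mα∸β))
      ≡⟨ regroup (a C b) Mαβ (b C f₀) Mβf ((a ∸ b) C d) Mα∸β ⟩
    ((a C b) * (b C f₀) * ((a ∸ b) C d)) * (Mαβ * (Mβf * Mα∸β))
      ≡⟨ cong₂ _*_ (binomial-revision a b f₀ d) (multiBinom-revision α β f≤e) ⟩
    ((a C (f₀ + d)) * ((f₀ + d) C f₀) * binom∸ (a ∸ (f₀ + d)) b f₀) * (Mαe * (Mef * M∸))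
      ≡⟨ regroup (a C (f₀ + d)) Mαe ((f₀ + d) C f₀) Mef (binom∸ (a ∸ (f₀ + d)) b f₀) M∸ ⟨
    ((a C (f₀ + d)) * Mαe) * ((((f₀ + d) C f₀) * Mef) * (binom∸ (a ∸ (f₀ + d)) b f₀ * M∸)) ∎
    where
    open ≡-Reasoning
    Mαβ = multiBinom α β
    Mβf = multiBinom β f
    Mα∸β = multiBinom (α ∸ᵛ β) (e ∸ᵛ f)
    Mαe = multiBinom α e
    Mef = multiBinom e f
    M∸ = multiBinom∸ (α ∸ᵛ e) β f
    regroup : ∀ x₁ y₁ x₂ y₂ x₃ y₃ → (x₁ * y₁) * ((x₂ * y₂) * (x₃ * y₃)) ≡ (x₁ * x₂ * x₃) * (y₁ * (y₂ * y₃))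
    regroup = solve 6 (λ x₁ y₁ x₂ y₂ x₃ y₃ → (x₁ :* y₁) :* ((x₂ :* y₂) :* (x₃ :* y₃))
                                            := (x₁ :* x₂ :* x₃) :* (y₁ :* (y₂ :* y₃))) refl

  multiVandermonde : ∀ {k} (α A f : Vec ℕ k) s m → (f +ᵛ A) ≤ᵛ α →
    ∑[ β ∈ below α ] (δ (s + ∣ β ∣) m * multiBinom∸ A β f) ≡ binom∸ ∣ A ∣ m (s + ∣ f ∣)
  multiVandermonde []      []       []       s m [] =
    trans (+-identityʳ _) (trans (*-identityʳ _) (sym (binom∸-zero m (s + 0))))
  multiVandermonde (a ∷ α) (A₀ ∷ A) (f₀ ∷ f) s m (f₀+A₀≤a ∷ f+A≤α) = begin
    ∑[ β ∈ below (a ∷ α) ] (δ (s + ∣ β ∣) m * multiBinom∸ (A₀ ∷ A) β (f₀ ∷ f))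
      ≡⟨ ∑-below-∷ a α _ ⟩
    ∑[ b < suc a ] ∑[ β ∈ below α ] (δ (s + (b + ∣ β ∣)) m * (binom∸ A₀ b f₀ * multiBinom∸ A β f))
      ≡⟨ ∑<-cong (suc a) (λ b _ → slice b) ⟩
    ∑[ b < suc a ] (binom∸ A₀ b f₀ * binom∸ ∣ A ∣ m (s + b + ∣ f ∣))
      ≡⟨ ∑-binom∸ f₀+A₀≤a (λ b → binom∸ ∣ A ∣ m (s + b + ∣ f ∣)) ⟩
    ∑[ b < suc A₀ ] ((A₀ C b) * binom∸ ∣ A ∣ m (s + (f₀ + b) + ∣ f ∣))
      ≡⟨ ∑<-cong (suc A₀) (λ b _ → cong (λ z → (A₀ C b) * binom∸ ∣ A ∣ m z) (reassoc s f₀ b ∣ f ∣)) ⟩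
    ∑[ b < suc A₀ ] ((A₀ C b) * binom∸ ∣ A ∣ m (s + (f₀ + ∣ f ∣) + b))
      ≡⟨ vandermonde A₀ ∣ A ∣ m (s + (f₀ + ∣ f ∣)) ⟩
    binom∸ (A₀ + ∣ A ∣) m (s + (f₀ + ∣ f ∣)) ∎
    where
    open ≡-Reasoning
    reassoc : ∀ s f₀ b F → s + (f₀ + b) + F ≡ s + (f₀ + F) + b
    reassoc = solve 4 (λ s f₀ b F → s :+ (f₀ :+ b) :+ F := s :+ (f₀ :+ F) :+ b) refl
    slice : ∀ b → ∑[ β ∈ below α ] (δ (s + (b + ∣ β ∣)) m * (binom∸ A₀ b f₀ * multiBinom∸ A β f))
                  ≡ binom∸ A₀ b f₀ * binom∸ ∣ A ∣ m (s + b + ∣ f ∣)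
    slice b = begin
      ∑[ β ∈ below α ] (δ (s + (b + ∣ β ∣)) m * (binom∸ A₀ b f₀ * multiBinom∸ A β f))
        ≡⟨ ∑-cong (below α) (λ β → trans (cong (λ z → δ z m * (binom∸ A₀ b f₀ * multiBinom∸ A β f)) (sym (+-assoc s b ∣ β ∣)))
                                          (*.x∙yz≈y∙xz (δ (s + b + ∣ β ∣) m) (binom∸ A₀ b f₀) _)) ⟩
      ∑[ β ∈ below α ] (binom∸ A₀ b f₀ * (δ (s + b + ∣ β ∣) m * multiBinom∸ A β f))
        ≡⟨ *-distribˡ-∑ (binom∸ A₀ b f₀) (below α) _ ⟨
      binom∸ A₀ b f₀ * ∑[ β ∈ below α ] (δ (s + b + ∣ β ∣) m * multiBinom∸ A β f)
        ≡⟨ cong (binom∸ A₀ b f₀ *_) (multiVandermonde α A f (s + b) m f+A≤α) ⟩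
      binom∸ A₀ b f₀ * binom∸ ∣ A ∣ m (s + b + ∣ f ∣) ∎

  ∑-multiBinom : ∀ {k} (e : Vec ℕ k) s m → ∑[ f ∈ below e ] (δ (s + ∣ f ∣) m * multiBinom e f) ≡ binom∸ ∣ e ∣ m s
  ∑-multiBinom {k} e s m = begin
    ∑[ f ∈ below e ] (δ (s + ∣ f ∣) m * multiBinom e f)
      ≡⟨ ∑-cong (below e) (λ f → cong (δ (s + ∣ f ∣) m *_) (sym (multiBinom∸-zero e f))) ⟩
    ∑[ f ∈ below e ] (δ (s + ∣ f ∣) m * multiBinom∸ e f 0ᵛ)
      ≡⟨ multiVandermonde e e 0ᵛ s m (0ᵛ+ᵛe≤ᵛe e) ⟩
    binom∸ (∣ e ∣) m (s + (∣ 0ᵛ {k} ∣))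
      ≡⟨ cong (binom∸ ∣ e ∣ m) (trans (cong (s +_) (∣0ᵛ∣ k)) (+-identityʳ s)) ⟩
    binom∸ ∣ e ∣ m s ∎
    where
    open ≡-Reasoning
    0ᵛ : ∀ {k} → Vec ℕ k
    0ᵛ = Vec.replicate _ 0
    multiBinom∸-zero : ∀ {k} (A β : Vec ℕ k) → multiBinom∸ A β 0ᵛ ≡ multiBinom A β
    multiBinom∸-zero []      []      = refl
    multiBinom∸-zero (a ∷ A) (b ∷ β) = cong ((a C b) *_) (multiBinom∸-zero A β)
    ∣0ᵛ∣ : ∀ k → ∣ 0ᵛ {k} ∣ ≡ 0
    ∣0ᵛ∣ zero    = refl
    ∣0ᵛ∣ (suc k) = ∣0ᵛ∣ k
    0ᵛ+ᵛe≤ᵛe : ∀ {k} (e : Vec ℕ k) → (0ᵛ +ᵛ e) ≤ᵛ e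
    0ᵛ+ᵛe≤ᵛe []      = []
    0ᵛ+ᵛe≤ᵛe (x ∷ e) = ≤-refl ∷ 0ᵛ+ᵛe≤ᵛe e

  ∑-multiBinom-revision : ∀ {k} (α e f : Vec ℕ k) m → f ≤ᵛ e →
    ∑[ β ∈ below α ] (δ ∣ β ∣ m * (multiBinom α β * (multiBinom β f * multiBinom (α ∸ᵛ β) (e ∸ᵛ f))))
    ≡ multiBinom α e * (multiBinom e f * binom∸ ∣ α ∸ᵛ e ∣ m (∣ f ∣))
  ∑-multiBinom-revision α e f m f≤e = begin
    ∑[ β ∈ below α ] (δ ∣ β ∣ m * (multiBinom α β * (multiBinom β f * multiBinom (α ∸ᵛ β) (e ∸ᵛ f))))
      ≡⟨ ∑-cong (below α) (λ β → cong (δ ∣ β ∣ m *_) (multiBinom-revision α β f≤e)) ⟩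
    ∑[ β ∈ below α ] (δ ∣ β ∣ m * (multiBinom α e * (multiBinom e f * multiBinom∸ (α ∸ᵛ e) β f)))
      ≡⟨ ∑-cong (below α) (λ β → trans (*.x∙yz≈y∙xz (δ ∣ β ∣ m) (multiBinom α e) _)
                                        (cong (multiBinom α e *_) (*.x∙yz≈y∙xz (δ ∣ β ∣ m) (multiBinom e f) _))) ⟩
    ∑[ β ∈ below α ] (multiBinom α e * (multiBinom e f * (δ ∣ β ∣ m * multiBinom∸ (α ∸ᵛ e) β f)))
      ≡⟨ trans (cong (multiBinom α e *_) (*-distribˡ-∑ (multiBinom e f) (below α) _)) (*-distribˡ-∑ (multiBinom α e) (below α) _) ⟨
    multiBinom α e * (multiBinom e f * ∑[ β ∈ below α ] (δ ∣ β ∣ m * multiBinom∸ (α ∸ᵛ e) β f))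
      ≡⟨ *-congˡ-unless-zero (multiBinom≡0⊎≤ᵛ α e) (λ e≤α →
           cong (multiBinom e f *_) (multiVandermonde α (α ∸ᵛ e) f 0 m (f+ᵛ[α∸ᵛe]≤ᵛα f≤e e≤α))) ⟩
    multiBinom α e * (multiBinom e f * binom∸ ∣ α ∸ᵛ e ∣ m (∣ f ∣)) ∎
    where
    open ≡-Reasoning
    f+ᵛ[α∸ᵛe]≤ᵛα : ∀ {k} {α e f : Vec ℕ k} → f ≤ᵛ e → e ≤ᵛ α → (f +ᵛ (α ∸ᵛ e)) ≤ᵛ α
    f+ᵛ[α∸ᵛe]≤ᵛα [] [] = []
    f+ᵛ[α∸ᵛe]≤ᵛα {α = a ∷ _} {e₀ ∷ _} {f₀ ∷ _} (f₀≤e₀ ∷ f≤e) (e₀≤a ∷ e≤α) =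
      subst (f₀ + (a ∸ e₀) ≤_) (m+[n∸m]≡n e₀≤a) (+-monoˡ-≤ (a ∸ e₀) f₀≤e₀) ∷ f+ᵛ[α∸ᵛe]≤ᵛα f≤e e≤α

  -- Derivatives of monomials

  [k+1]*nC[k+1]+k*nCk≡n*nCk : ∀ n k → suc k * (n C suc k) + k * (n C k) ≡ n * (n C k)
  [k+1]*nC[k+1]+k*nCk≡n*nCk zero    zero    = refl
  [k+1]*nC[k+1]+k*nCk≡n*nCk zero    (suc k) = cong₂ _+_ (*-zeroʳ (suc (suc k))) (*-zeroʳ (suc k))
  [k+1]*nC[k+1]+k*nCk≡n*nCk (suc n) zero    =
    trans (+-identityʳ _) (trans (*-identityˡ _) (trans (nC1≡n (suc n)) (sym (*-identityʳ (suc n)))))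
  [k+1]*nC[k+1]+k*nCk≡n*nCk (suc n) (suc k) = begin
    suc (suc k) * (suc n C suc (suc k)) + suc k * (suc n C suc k)
      ≡⟨ cong₂ (λ u v → suc (suc k) * u + suc k * v) (pascal n (suc k)) (pascal n k) ⟩
    suc (suc k) * (y + z) + suc k * (x + y)
      ≡⟨ solve 4 (λ k x y z → (con 2 :+ k) :* (y :+ z) :+ (con 1 :+ k) :* (x :+ y)
                              := y :+ x :+ ((con 2 :+ k) :* z :+ (con 1 :+ k) :* y) :+ ((con 1 :+ k) :* y :+ k :* x)) refl k x y z ⟩
    y + x + (suc (suc k) * z + suc k * y) + (suc k * y + k * x)
      ≡⟨ cong₂ (λ u v → y + x + u + v) ([k+1]*nC[k+1]+k*nCk≡n*nCk n (suc k)) ([k+1]*nC[k+1]+k*nCk≡n*nCk n k) ⟩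
    y + x + n * y + n * x
      ≡⟨ solve 3 (λ n x y → y :+ x :+ n :* y :+ n :* x := (con 1 :+ n) :* (x :+ y)) refl n x y ⟩
    suc n * (x + y)
      ≡⟨ cong (suc n *_) (pascal n k) ⟨
    suc n * (suc n C suc k) ∎
    where
    open ≡-Reasoning
    pascal : ∀ n k → suc n C suc k ≡ n C k + n C suc k
    pascal n k = sym (nCk+nC[k+1]≡[n+1]C[k+1] n k)
    x = n C k
    y = n C suc k
    z = n C suc (suc k)

  inc : ∀ {k} → Vec ℕ k → Fin k → Vec ℕ k
  inc e i = updateAt e i suc

  ∣inc∣ : ∀ {k} (e : Vec ℕ k) i → ∣ inc e i ∣ ≡ suc ∣ e ∣
  ∣inc∣ (x ∷ e) fzero    = refl
  ∣inc∣ (x ∷ e) (fsuc i) = trans (cong (x +_) (∣inc∣ e i)) (+-suc x _)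

  multiBinom-absorption : ∀ {k} (β e : Vec ℕ k) →
    sum (λ i → suc (lookup e i) * multiBinom β (inc e i)) + ∣ e ∣ * multiBinom β e ≡ ∣ β ∣ * multiBinom β e
  multiBinom-absorption []      []      = refl
  multiBinom-absorption (b ∷ β) (c ∷ e) = begin
    suc c * ((b C suc c) * M) + sum (λ i → suc (lookup e i) * ((b C c) * multiBinom β (inc e i))) + (c + ∣ e ∣) * ((b C c) * M)
      ≡⟨ cong (λ z → suc c * ((b C suc c) * M) + z + (c + ∣ e ∣) * ((b C c) * M))
              (trans (sum-cong-≗ (λ i → *.x∙yz≈y∙xz (suc (lookup e i)) (b C c) _)) (sym (*-distribˡ-sum (b C c) t))) ⟩
    suc c * ((b C suc c) * M) + (b C c) * sum t + (c + ∣ e ∣) * ((b C c) * M)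
      ≡⟨ solve 6 (λ c P M Q X E → (con 1 :+ c) :* (P :* M) :+ Q :* X :+ (c :+ E) :* (Q :* M)
                                  := ((con 1 :+ c) :* P :+ c :* Q) :* M :+ Q :* (X :+ E :* M)) refl c (b C suc c) M (b C c) (sum t) ∣ e ∣ ⟩
    (suc c * (b C suc c) + c * (b C c)) * M + (b C c) * (sum t + ∣ e ∣ * M)
      ≡⟨ cong₂ (λ u v → u * M + (b C c) * v) ([k+1]*nC[k+1]+k*nCk≡n*nCk b c) (multiBinom-absorption β e) ⟩
    (b * (b C c)) * M + (b C c) * (∣ β ∣ * M)
      ≡⟨ solve 4 (λ b Q M B → (b :* Q) :* M :+ Q :* (B :* M) := (b :+ B) :* (Q :* M)) refl b (b C c) M ∣ β ∣ ⟩
    (b + ∣ β ∣) * ((b C c) * M) ∎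
    where
    open ≡-Reasoning
    M = multiBinom β e
    t : Fin _ → ℕ
    t i = suc (lookup e i) * multiBinom β (inc e i)

  -- the coefficient of ω^e in D_p(ω^β)
  derivCoeff : ∀ {k} → ℕ → Vec ℕ k → Vec ℕ k → ℕ
  derivCoeff p β e = δ (∣ e ∣ + p) ∣ β ∣ * (p ! * multiBinom β e)

  derivCoeff-zero : ∀ {k} (β e : Vec ℕ k) → derivCoeff 0 β e ≡ (if does (≡-dec _≟_ β e) then 1 else 0)
  derivCoeff-zero β e with ≡-dec _≟_ β e
  ... | yes refl = cong₂ _*_ (δ-≡ (+-identityʳ ∣ β ∣)) (trans (*-identityˡ _) (multiBinom-diag β))
  ... | no  β≢e  = δ-elim (∣ e ∣ + 0) ∣ β ∣ (λ d → d * (1 * multiBinom β e) ≡ 0)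
                     (λ sizes → trans (*-identityˡ _) (trans (*-identityˡ _) (vanish sizes))) (λ _ → refl)
    where
    vanish : ∣ e ∣ + 0 ≡ ∣ β ∣ → multiBinom β e ≡ 0
    vanish sizes with multiBinom≡0⊎≤ᵛ β e
    ... | inj₁ vanishes = vanishes
    ... | inj₂ e≤β  = ⊥-elim (β≢e (sym (≤ᵛ∧∣∣≡⇒≡ e≤β (trans (sym (+-identityʳ ∣ e ∣)) sizes))))

  derivCoeff-suc : ∀ {k} p (β e : Vec ℕ k) → sum (λ i → suc (lookup e i) * derivCoeff p β (inc e i)) ≡ derivCoeff (suc p) β e
  derivCoeff-suc p β e = begin
    sum (λ i → suc (lookup e i) * derivCoeff p β (inc e i))
      ≡⟨ sum-cong-≗ term ⟩
    sum (λ i → δ′ * (p ! * (suc (lookup e i) * multiBinom β (inc e i))))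
      ≡⟨ trans (cong (δ′ *_) (*-distribˡ-sum (p !) t)) (*-distribˡ-sum δ′ (λ i → p ! * t i)) ⟨
    δ′ * (p ! * sum t)
      ≡⟨ δ-*-cong (∣ e ∣ + suc p) ∣ β ∣ (λ sizes → trans (cong (p ! *_) (∑t≡[1+p]*M sizes)) (*.x∙yz≈yx∙z (p !) (suc p) M)) ⟩
    δ′ * (suc p ! * multiBinom β e) ∎
    where
    open ≡-Reasoning
    δ′ = δ (∣ e ∣ + suc p) ∣ β ∣
    M = multiBinom β e
    t : Fin _ → ℕ
    t i = suc (lookup e i) * multiBinom β (inc e i)
    ∑t≡[1+p]*M : ∣ e ∣ + suc p ≡ ∣ β ∣ → sum t ≡ suc p * M
    ∑t≡[1+p]*M sizes = +-cancelʳ-≡ (∣ e ∣ * M) (sum t) (suc p * M) (begin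
      sum t + ∣ e ∣ * M           ≡⟨ multiBinom-absorption β e ⟩
      ∣ β ∣ * M                   ≡⟨ cong (_* M) sizes ⟨
      (∣ e ∣ + suc p) * M         ≡⟨ *-distribʳ-+ M ∣ e ∣ (suc p) ⟩
      ∣ e ∣ * M + suc p * M       ≡⟨ +-comm (∣ e ∣ * M) _ ⟩
      suc p * M + ∣ e ∣ * M       ∎)
    term : ∀ i → suc (lookup e i) * derivCoeff p β (inc e i) ≡ δ′ * (p ! * (suc (lookup e i) * multiBinom β (inc e i)))
    term i rewrite ∣inc∣ e i | sym (+-suc ∣ e ∣ p) =
      solve 4 (λ a d f m → a :* (d :* (f :* m)) := d :* (f :* (a :* m))) refl (suc (lookup e i)) δ′ (p !) (multiBinom β (inc e i))

  ∑-filter-size : ∀ {k} (xs : List (Vec ℕ k)) m g → ∑ (filter (λ β → ∣ β ∣ ≟ m) xs) g ≡ ∑[ β ∈ xs ] (δ ∣ β ∣ m * g β)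
  ∑-filter-size []       m g = refl
  ∑-filter-size (β ∷ xs) m g with ∣ β ∣ ≟ m
  ... | yes ∣β∣≡m rewrite filter-accept (λ β → ∣ β ∣ ≟ m) {β} {xs} ∣β∣≡m | δ-≡ ∣β∣≡m =
    cong₂ _+_ (sym (+-identityʳ (g β))) (∑-filter-size xs m g)
  ... | no  ∣β∣≢m rewrite filter-reject (λ β → ∣ β ∣ ≟ m) {β} {xs} ∣β∣≢m | δ-≢ ∣β∣≢m = ∑-filter-size xs m g

  δ-sizes : ∀ x y b r {E n} p q m → y + x ≡ E → r + b ≡ n →
            δ b m * (δ (x + p) b * δ (y + q) r) ≡ δ b m * (δ (E + (p + q)) n * δ (p + x) m)
  δ-sizes x y b r {E} {n} p q m y+x≡E r+b≡n = δ-*-cong b m λ { refl → begin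
    δ (x + p) b * δ (y + q) r         ≡⟨ δ-*-cong (x + p) b (λ x+p≡b →
                                           trans (sym (δ-+ˡ b (y + q) r)) (cong₂ δ (b+[y+q]≡E+[p+q] x+p≡b) b+r≡n)) ⟩
    δ (x + p) b * δ (E + (p + q)) n   ≡⟨ *-comm (δ (x + p) b) _ ⟩
    δ (E + (p + q)) n * δ (x + p) b   ≡⟨ cong (λ z → δ (E + (p + q)) n * δ z b) (+-comm x p) ⟩
    δ (E + (p + q)) n * δ (p + x) b   ∎ }
    where
    open ≡-Reasoning
    b+r≡n : b + r ≡ n
    b+r≡n = trans (+-comm b r) r+b≡n
    b+[y+q]≡E+[p+q] : x + p ≡ b → b + (y + q) ≡ E + (p + q)
    b+[y+q]≡E+[p+q] refl = trans (solve 4 (λ x p y q → (x :+ p) :+ (y :+ q) := (y :+ x) :+ (p :+ q)) refl x p y q) (cong (_+ (p + q)) y+x≡E)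

  derivCoeff-product : ∀ {k} {α β e f : Vec ℕ k} p q m → β ≤ᵛ α → f ≤ᵛ e →
    δ ∣ β ∣ m * (derivCoeff p β f * derivCoeff q (α ∸ᵛ β) (e ∸ᵛ f))
    ≡ (δ (∣ e ∣ + (p + q)) ∣ α ∣ * (p ! * q !))
      * (δ (p + ∣ f ∣) m * (δ ∣ β ∣ m * (multiBinom β f * multiBinom (α ∸ᵛ β) (e ∸ᵛ f))))
  derivCoeff-product {α = α} {β} {e} {f} p q m β≤α f≤e = begin
    δₘ * ((δ (∣ f ∣ + p) ∣ β ∣ * (p ! * Mβf)) * (δ (∣ e ∸ᵛ f ∣ + q) ∣ α ∸ᵛ β ∣ * (q ! * Mα∸β)))
      ≡⟨ solve 7 (λ δₘ δ₁ P B δ₂ Q B′ → δₘ :* ((δ₁ :* (P :* B)) :* (δ₂ :* (Q :* B′)))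
                                       := (δₘ :* (δ₁ :* δ₂)) :* ((P :* Q) :* (B :* B′))) refl
           δₘ (δ (∣ f ∣ + p) ∣ β ∣) (p !) Mβf (δ (∣ e ∸ᵛ f ∣ + q) ∣ α ∸ᵛ β ∣) (q !) Mα∸β ⟩
    (δₘ * (δ (∣ f ∣ + p) ∣ β ∣ * δ (∣ e ∸ᵛ f ∣ + q) ∣ α ∸ᵛ β ∣)) * ((p ! * q !) * (Mβf * Mα∸β))
      ≡⟨ cong (_* ((p ! * q !) * (Mβf * Mα∸β)))
              (δ-sizes (∣ f ∣) (∣ e ∸ᵛ f ∣) (∣ β ∣) (∣ α ∸ᵛ β ∣) p q m (∣α∸β∣+∣β∣≡∣α∣ f≤e) (∣α∸β∣+∣β∣≡∣α∣ β≤α)) ⟩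
    (δₘ * (δₙ * δₚ)) * ((p ! * q !) * (Mβf * Mα∸β))
      ≡⟨ solve 5 (λ δₘ δₙ δₚ PQ w → (δₘ :* (δₙ :* δₚ)) :* (PQ :* w) := (δₙ :* PQ) :* (δₚ :* (δₘ :* w))) refl
           δₘ δₙ δₚ (p ! * q !) (Mβf * Mα∸β) ⟩
    (δₙ * (p ! * q !)) * (δₚ * (δₘ * (Mβf * Mα∸β))) ∎
    where
    open ≡-Reasoning
    δₘ = δ ∣ β ∣ m
    δₙ = δ (∣ e ∣ + (p + q)) ∣ α ∣
    δₚ = δ (p + ∣ f ∣) m
    Mβf = multiBinom β f
    Mα∸β = multiBinom (α ∸ᵛ β) (e ∸ᵛ f)

  lhsCoeff : ∀ {k} → Vec ℕ k → ℕ → ℕ → ℕ → Vec ℕ k → ℕ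
  lhsCoeff α m p q e =
    ∑[ β ∈ belowOfSize α m ] (multiBinom α β * ∑[ f ∈ below e ] (derivCoeff p β f * derivCoeff q (α ∸ᵛ β) (e ∸ᵛ f)))

  derivCoeff-identity : ∀ {k} (α e : Vec ℕ k) m p q → lhsCoeff α m p q e ≡ binom∸ ∣ e ∣ m p * derivCoeff (p + q) α e
  derivCoeff-identity α e m p q = begin
    ∑[ β ∈ belowOfSize α m ] (multiBinom α β * ∑[ f ∈ below e ] term β f)
      ≡⟨ ∑-filter-size (below α) m _ ⟩
    ∑[ β ∈ below α ] (δ ∣ β ∣ m * (multiBinom α β * ∑[ f ∈ below e ] term β f))
      ≡⟨ ∑-below-cong α expand ⟩
    ∑[ β ∈ below α ] (K * ∑[ f ∈ below e ] (δₚ f * weight β f))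
      ≡⟨ *-distribˡ-∑ K (below α) _ ⟨
    K * ∑[ β ∈ below α ] ∑[ f ∈ below e ] (δₚ f * weight β f)
      ≡⟨ cong (K *_) (∑-comm (below α) (below e) _) ⟩
    K * ∑[ f ∈ below e ] ∑[ β ∈ below α ] (δₚ f * weight β f)
      ≡⟨ cong (K *_) (∑-cong (below e) (λ f → *-distribˡ-∑ (δₚ f) (below α) _)) ⟨
    K * ∑[ f ∈ below e ] (δₚ f * ∑[ β ∈ below α ] weight β f)
      ≡⟨ cong (K *_) (∑-below-cong e sum-over-β) ⟩
    K * ∑[ f ∈ below e ] ((multiBinom α e * (Y C p)) * (δₚ f * multiBinom e f))
      ≡⟨ cong (K *_) (trans (sym (*-distribˡ-∑ (multiBinom α e * (Y C p)) (below e) _))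
                            (cong (multiBinom α e * (Y C p) *_) (∑-multiBinom e p m))) ⟩
    K * ((multiBinom α e * (Y C p)) * binom∸ ∣ e ∣ m p)
      ≡⟨ collect ⟩
    binom∸ ∣ e ∣ m p * derivCoeff (p + q) α e ∎
    where
    open ≡-Reasoning
    Y = ∣ α ∸ᵛ e ∣
    K = δ (∣ e ∣ + (p + q)) ∣ α ∣ * (p ! * q !)
    δₚ : Vec ℕ _ → ℕ
    δₚ f = δ (p + ∣ f ∣) m
    term weight : Vec ℕ _ → Vec ℕ _ → ℕ
    term β f = derivCoeff p β f * derivCoeff q (α ∸ᵛ β) (e ∸ᵛ f)
    weight β f = δ ∣ β ∣ m * (multiBinom α β * (multiBinom β f * multiBinom (α ∸ᵛ β) (e ∸ᵛ f)))

    expand : ∀ β → β ≤ᵛ α →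
             δ ∣ β ∣ m * (multiBinom α β * ∑[ f ∈ below e ] term β f) ≡ K * ∑[ f ∈ below e ] (δₚ f * weight β f)
    expand β β≤α = begin
      δ ∣ β ∣ m * (multiBinom α β * ∑[ f ∈ below e ] term β f)
        ≡⟨ trans (*.x∙yz≈y∙xz (δ ∣ β ∣ m) (multiBinom α β) _)
                 (cong (multiBinom α β *_) (*-distribˡ-∑ (δ ∣ β ∣ m) (below e) (term β))) ⟩
      multiBinom α β * ∑[ f ∈ below e ] (δ ∣ β ∣ m * term β f)
        ≡⟨ cong (multiBinom α β *_) (∑-below-cong e (λ f f≤e → derivCoeff-product p q m β≤α f≤e)) ⟩
      multiBinom α β * ∑[ f ∈ below e ] (K * (δₚ f * (δ ∣ β ∣ m * w f)))
        ≡⟨ trans (*-distribˡ-∑ (multiBinom α β) (below e) _)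
                 (∑-cong (below e) (λ f → regroup (multiBinom α β) K (δₚ f) (δ ∣ β ∣ m) (w f))) ⟩
      ∑[ f ∈ below e ] (K * (δₚ f * weight β f))
        ≡⟨ *-distribˡ-∑ K (below e) _ ⟨
      K * ∑[ f ∈ below e ] (δₚ f * weight β f) ∎
      where
      w : Vec ℕ _ → ℕ
      w f = multiBinom β f * multiBinom (α ∸ᵛ β) (e ∸ᵛ f)
      regroup : ∀ M K D δ w → M * (K * (D * (δ * w))) ≡ K * (D * (δ * (M * w)))
      regroup = solve 5 (λ M K D δ w → M :* (K :* (D :* (δ :* w))) := K :* (D :* (δ :* (M :* w)))) refl

    sum-over-β : ∀ f → f ≤ᵛ e → δₚ f * ∑[ β ∈ below α ] weight β f ≡ (multiBinom α e * (Y C p)) * (δₚ f * multiBinom e f)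
    sum-over-β f f≤e = begin
      δₚ f * ∑[ β ∈ below α ] weight β f
        ≡⟨ cong (δₚ f *_) (∑-multiBinom-revision α e f m f≤e) ⟩
      δₚ f * (multiBinom α e * (multiBinom e f * binom∸ Y m (∣ f ∣)))
        ≡⟨ δ-*-cong (p + ∣ f ∣) m (λ p+∣f∣≡m → cong (λ z → multiBinom α e * (multiBinom e f * z)) (binom∸-p+∣f∣ p+∣f∣≡m)) ⟩
      δₚ f * (multiBinom α e * (multiBinom e f * (Y C p)))
        ≡⟨ solve 4 (λ D M B C → D :* (M :* (B :* C)) := (M :* C) :* (D :* B)) refl (δₚ f) (multiBinom α e) (multiBinom e f) (Y C p) ⟩
      (multiBinom α e * (Y C p)) * (δₚ f * multiBinom e f) ∎
      where
      binom∸-p+∣f∣ : p + ∣ f ∣ ≡ m → binom∸ Y m (∣ f ∣) ≡ Y C p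
      binom∸-p+∣f∣ refl = trans (cong (λ z → binom∸ Y z (∣ f ∣)) (+-comm p ∣ f ∣)) (binom∸-+ Y ∣ f ∣ p)

    collect : K * ((multiBinom α e * (Y C p)) * binom∸ ∣ e ∣ m p) ≡ binom∸ ∣ e ∣ m p * derivCoeff (p + q) α e
    collect = begin
      K * ((multiBinom α e * (Y C p)) * binom∸ ∣ e ∣ m p)
        ≡⟨ solve 5 (λ δ PQ M C B → (δ :* PQ) :* ((M :* C) :* B) := δ :* (B :* (M :* (C :* PQ)))) refl
                   δₙ (p ! * q !) (multiBinom α e) (Y C p) B ⟩
      δₙ * (B * (multiBinom α e * ((Y C p) * (p ! * q !))))
        ≡⟨ δ-*-cong (∣ e ∣ + (p + q)) ∣ α ∣ (λ sizes → cong (B *_) (*-congˡ-unless-zero (multiBinom≡0⊎≤ᵛ α e) (λ e≤α →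
             trans (cong (λ z → (z C p) * (p ! * q !)) (Y≡p+q e≤α sizes)) ([m+n]Cm*[m!*n!]≡[m+n]! p q)))) ⟩
      δₙ * (B * (multiBinom α e * (p + q) !))
        ≡⟨ solve 4 (λ δ B M F → δ :* (B :* (M :* F)) := B :* (δ :* (F :* M))) refl δₙ B (multiBinom α e) ((p + q) !) ⟩
      B * (δₙ * ((p + q) ! * multiBinom α e)) ∎
      where
      δₙ = δ (∣ e ∣ + (p + q)) ∣ α ∣
      B = binom∸ ∣ e ∣ m p
      Y≡p+q : e ≤ᵛ α → ∣ e ∣ + (p + q) ≡ ∣ α ∣ → Y ≡ p + q
      Y≡p+q e≤α sizes = +-cancelʳ-≡ ∣ e ∣ Y (p + q) (trans (∣α∸β∣+∣β∣≡∣α∣ e≤α) (trans (sym sizes) (+-comm ∣ e ∣ (p + q))))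

module IntegerBinomial where

  open import Data.Nat using (_+_; _*_; _!)
  open import Data.Nat.Properties using (*-commutativeSemigroup)
  open import Data.Integer as ℤ using (_⊖_)
  open import Data.Integer.Properties using (pos-+; m-n≡m⊖n; [1+m]⊖[1+n]≡m⊖n)
  open import Data.Integer.Solver using (module +-*-Solver)
  open import Algebra.Properties.CommutativeSemigroup *-commutativeSemigroup using (x∙yz≈y∙xz)
  open import Relation.Binary.PropositionalEquality
  open +-*-Solver
  open Combinatorics

  binomℤ-⊖ : ∀ X m p → binomℤ (ℤ.+ X) (m ⊖ p) ≡ binom∸ X m p
  binomℤ-⊖ X m       zero    = refl
  binomℤ-⊖ X zero    (suc p) = refl
  binomℤ-⊖ X (suc m) (suc p) = trans (cong (binomℤ (ℤ.+ X)) ([1+m]⊖[1+n]≡m⊖n m p)) (binomℤ-⊖ X m p)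

  binomℤ≡binom∸ : ∀ {n} X m p q → X + (p + q) ≡ n →
                  binomℤ (ℤ.+ n ℤ.- ℤ.+ p ℤ.- ℤ.+ q) (ℤ.+ m ℤ.- ℤ.+ p) ≡ binom∸ X m p
  binomℤ≡binom∸ X m p q refl = trans (cong₂ binomℤ X+p+q-p-q≡X (m-n≡m⊖n m p)) (binomℤ-⊖ X m p)
    where
    X+p+q-p-q≡X : ℤ.+ (X + (p + q)) ℤ.- ℤ.+ p ℤ.- ℤ.+ q ≡ ℤ.+ X
    X+p+q-p-q≡X rewrite pos-+ X (p + q) | pos-+ p q =
      solve 3 (λ x p q → (x :+ (p :+ q)) :- p :- q := x) refl (ℤ.+ X) (ℤ.+ p) (ℤ.+ q)

  rhsCoeff : ∀ {k} → Vec ℕ k → ℕ → ℕ → ℕ → ℕ → Vec ℕ k → ℕ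
  rhsCoeff α n m p q e = binomℤ (ℤ.+ n ℤ.- ℤ.+ p ℤ.- ℤ.+ q) (ℤ.+ m ℤ.- ℤ.+ p) * derivCoeff (p + q) α e

  -- derivCoeff (p + q) α e vanishes unless ∣ α ∣ = ∣ e ∣ + (p + q).
  lhsCoeff≡rhsCoeff : ∀ {k} (α e : Vec ℕ k) m p q → lhsCoeff α m p q e ≡ rhsCoeff α ∣ α ∣ m p q e
  lhsCoeff≡rhsCoeff α e m p q = begin
    lhsCoeff α m p q e                      ≡⟨ derivCoeff-identity α e m p q ⟩
    binom∸ ∣ e ∣ m p * (δₙ * M)              ≡⟨ x∙yz≈y∙xz (binom∸ ∣ e ∣ m p) δₙ M ⟩
    δₙ * (binom∸ ∣ e ∣ m p * M)              ≡⟨ δ-*-cong (∣ e ∣ + (p + q)) ∣ α ∣ (λ sizes →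
                                                 cong (_* M) (sym (binomℤ≡binom∸ ∣ e ∣ m p q sizes))) ⟩
    δₙ * (B * M)                            ≡⟨ x∙yz≈y∙xz δₙ B M ⟩
    B * (δₙ * M)                            ∎
    where
    open ≡-Reasoning
    B = binomℤ (ℤ.+ ∣ α ∣ ℤ.- ℤ.+ p ℤ.- ℤ.+ q) (ℤ.+ m ℤ.- ℤ.+ p)
    δₙ = δ (∣ e ∣ + (p + q)) ∣ α ∣
    M = (p + q) ! * multiBinom α e

module Coefficients where

  import Data.Nat as ℕ
  import Data.Nat.Properties as ℕ
  import Data.Nat.Coprimality as Coprimality
  import Data.Integer as ℤ
  import Data.Integer.Properties as ℤ
  open import Data.Rational using (ℚ; 0ℚ; 1ℚ; mkℚ; _+_; _*_; _/_)
  open import Data.Rational.Properties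
    using (+-*-commutativeRing; normalize-coprime; +-identityˡ; +-identityʳ; *-zeroʳ; *-zeroˡ; *-comm; *-distribˡ-+; *-distribʳ-+)
  open import Data.Vec.Relation.Binary.Pointwise.Inductive using () renaming (decidable to pointwise?)
  open import Data.List.Properties using (++-identityʳ)
  open import Relation.Nullary using (Dec)
  open import Relation.Binary.PropositionalEquality hiding ([_])
  open Sums (CommutativeRing.commutativeSemiring +-*-commutativeRing)
  module ℕΣ = Sums ℕ.+-*-commutativeSemiring
  open Combinatorics
  open IntegerBinomial

  ℕtoℚ≡mkℚ : ∀ n → ℕtoℚ n ≡ mkℚ (ℤ.+ n) 0 (Coprimality.sym (Coprimality.1-coprimeTo n))
  ℕtoℚ≡mkℚ n = normalize-coprime (Coprimality.sym (Coprimality.1-coprimeTo n))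

  ℕtoℚ-+ : ∀ a b → ℕtoℚ (a ℕ.+ b) ≡ ℕtoℚ a + ℕtoℚ b
  ℕtoℚ-+ a b = trans (cong (_/ 1) (trans (ℤ.pos-+ a b) (sym (cong₂ ℤ._+_ (ℤ.*-identityʳ (ℤ.+ a)) (ℤ.*-identityʳ (ℤ.+ b))))))
                     (sym (cong₂ _+_ (ℕtoℚ≡mkℚ a) (ℕtoℚ≡mkℚ b)))

  ℕtoℚ-* : ∀ a b → ℕtoℚ (a ℕ.* b) ≡ ℕtoℚ a * ℕtoℚ b
  ℕtoℚ-* a b = trans (cong (_/ 1) (ℤ.pos-* a b)) (sym (cong₂ _*_ (ℕtoℚ≡mkℚ a) (ℕtoℚ≡mkℚ b)))

  ℕtoℚ-∑ : ∀ {A : Set} (xs : List A) g → ℕtoℚ (ℕΣ.∑ xs g) ≡ ∑[ x ∈ xs ] ℕtoℚ (g x)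
  ℕtoℚ-∑ []       g = refl
  ℕtoℚ-∑ (x ∷ xs) g = trans (ℕtoℚ-+ (g x) _) (cong (ℕtoℚ (g x) +_) (ℕtoℚ-∑ xs g))

  ℕtoℚ-sum : ∀ {k} (g : Fin k → ℕ) → ℕtoℚ (ℕΣ.sum g) ≡ sum (ℕtoℚ ∘ g)
  ℕtoℚ-sum {zero}  g = refl
  ℕtoℚ-sum {suc k} g = trans (ℕtoℚ-+ (g fzero) _) (cong (ℕtoℚ (g fzero) +_) (ℕtoℚ-sum (g ∘ fsuc)))

  _≟ᵛ_ : ∀ {k} (f e : Mono k) → Dec (f ≡ e)
  _≟ᵛ_ = ≡-dec ℕ._≟_

  _≤ᵛ?_ : ∀ {k} (f e : Mono k) → Dec (f ≤ᵛ e)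
  _≤ᵛ?_ = pointwise? ℕ._≤?_

  termCoeff : ∀ {k} → ℚ × Mono k → Mono k → ℚ
  termCoeff (c , f) e = if does (f ≟ᵛ e) then c else 0ℚ

  coeff-∷ : ∀ {k} (t : ℚ × Mono k) P e → coeff (t ∷ P) e ≡ termCoeff t e + coeff P e
  coeff-∷ (c , f) P e with f ≟ᵛ e
  ... | yes _ = refl
  ... | no  _ = sym (+-identityˡ _)

  coeff≡∑ : ∀ {k} (P : Poly k) e → coeff P e ≡ ∑[ t ∈ P ] termCoeff t e
  coeff≡∑ []      e = refl
  coeff≡∑ (t ∷ P) e = trans (coeff-∷ t P e) (cong (termCoeff t e +_) (coeff≡∑ P e))

  coeff-++ : ∀ {k} (P Q : Poly k) e → coeff (P ++ Q) e ≡ coeff P e + coeff Q e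
  coeff-++ P Q e = trans (coeff≡∑ (P ++ Q) e) (trans (∑-++ P Q _) (sym (cong₂ _+_ (coeff≡∑ P e) (coeff≡∑ Q e))))

  coeff-concatMap : ∀ {k} {A : Set} (h : A → Poly k) xs e → coeff (concatMap h xs) e ≡ ∑[ x ∈ xs ] coeff (h x) e
  coeff-concatMap h []       e = refl
  coeff-concatMap h (x ∷ xs) e = trans (coeff-++ (h x) _ e) (cong (coeff (h x) e +_) (coeff-concatMap h xs e))

  coeff-sumP : ∀ {k} (Ps : List (Poly k)) e → coeff (sumP Ps) e ≡ ∑[ P ∈ Ps ] coeff P e
  coeff-sumP []       e = refl
  coeff-sumP (P ∷ Ps) e = trans (coeff-++ P (sumP Ps) e) (cong (coeff P e +_) (coeff-sumP Ps e))

  coeff-scaleP : ∀ {k} a (P : Poly k) e → coeff (scaleP a P) e ≡ a * coeff P e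
  coeff-scaleP a []            e = sym (*-zeroʳ a)
  coeff-scaleP a ((c , f) ∷ P) e = begin
    coeff ((a * c , f) ∷ scaleP a P) e              ≡⟨ coeff-∷ (a * c , f) (scaleP a P) e ⟩
    termCoeff (a * c , f) e + coeff (scaleP a P) e  ≡⟨ cong₂ _+_ scale-term (coeff-scaleP a P e) ⟩
    a * termCoeff (c , f) e + a * coeff P e         ≡⟨ *-distribˡ-+ a _ _ ⟨
    a * (termCoeff (c , f) e + coeff P e)           ≡⟨ cong (a *_) (coeff-∷ (c , f) P e) ⟨
    a * coeff ((c , f) ∷ P) e                       ∎
    where
    open ≡-Reasoning
    scale-term : termCoeff (a * c , f) e ≡ a * termCoeff (c , f) e
    scale-term with does (f ≟ᵛ e)
    ... | true  = refl
    ... | false = sym (*-zeroʳ a)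

  coeff-mono : ∀ {k} (β e : Mono k) → coeff (mono β) e ≡ ℕtoℚ (if does (β ≟ᵛ e) then 1 else 0)
  coeff-mono β e with β ≟ᵛ e
  ... | yes _ = +-identityʳ 1ℚ
  ... | no  _ = refl

  termCoeff-∂term : ∀ {k} (i : Fin k) c (f e : Mono k) →
                    termCoeff (∂term i (c , f)) e ≡ ℕtoℚ (suc (lookup e i)) * termCoeff (c , f) (inc e i)
  termCoeff-∂term fzero c (zero ∷ f) (y ∷ e) with does ((zero ∷ f) ≟ᵛ (y ∷ e))
  ... | true  = trans (*-zeroʳ c) (sym (*-zeroʳ (ℕtoℚ (suc y))))
  ... | false = sym (*-zeroʳ (ℕtoℚ (suc y)))
  termCoeff-∂term fzero c (suc x ∷ f) (y ∷ e) with x ℕ.≡ᵇ y in x≡ᵇy | does (f ≟ᵛ e)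
  ... | true  | true  rewrite ℕ.≡ᵇ⇒≡ x y (subst T (sym x≡ᵇy) _) = *-comm c (ℕtoℚ (suc y))
  ... | true  | false = sym (*-zeroʳ (ℕtoℚ (suc y)))
  ... | false | _     = sym (*-zeroʳ (ℕtoℚ (suc y)))
  termCoeff-∂term (fsuc i) c (x ∷ f) (y ∷ e) with x ℕ.≡ᵇ y
  ... | true  = termCoeff-∂term i c f e
  ... | false = sym (*-zeroʳ (ℕtoℚ (suc (lookup e i))))

  coeff-∂ : ∀ {k} i (P : Poly k) e → coeff (∂ i P) e ≡ ℕtoℚ (suc (lookup e i)) * coeff P (inc e i)
  coeff-∂ i P e = begin
    coeff (∂ i P) e                              ≡⟨ coeff≡∑ (∂ i P) e ⟩
    ∑[ t ∈ List.map (∂term i) P ] termCoeff t e  ≡⟨ ∑-map (∂term i) P (λ t → termCoeff t e) ⟩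
    ∑[ t ∈ P ] termCoeff (∂term i t) e           ≡⟨ ∑-cong P (λ (c , f) → termCoeff-∂term i c f e) ⟩
    ∑[ t ∈ P ] (c * termCoeff t (inc e i))       ≡⟨ *-distribˡ-∑ c P (λ t → termCoeff t (inc e i)) ⟨
    c * ∑[ t ∈ P ] termCoeff t (inc e i)         ≡⟨ cong (c *_) (coeff≡∑ P (inc e i)) ⟨
    c * coeff P (inc e i)                        ∎
    where
    open ≡-Reasoning
    c = ℕtoℚ (suc (lookup e i))

  coeff-D₁ : ∀ {k} (P : Poly k) e → coeff (D₁ P) e ≡ sum (λ i → ℕtoℚ (suc (lookup e i)) * coeff P (inc e i))
  coeff-D₁ {k} P e = begin
    coeff (D₁ P) e                         ≡⟨ coeff-concatMap (λ i → ∂ i P) (allFin k) e ⟩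
    ∑[ i ∈ allFin k ] coeff (∂ i P) e      ≡⟨ ∑-tabulate (λ i → i) (λ i → coeff (∂ i P) e) ⟩
    sum (λ i → coeff (∂ i P) e)            ≡⟨ sum-cong-≗ (λ i → coeff-∂ i P e) ⟩
    sum (λ i → ℕtoℚ (suc (lookup e i)) * coeff P (inc e i)) ∎
    where open ≡-Reasoning

  coeff-D-mono : ∀ {k} p (β e : Mono k) → coeff (D p (mono β)) e ≡ ℕtoℚ (derivCoeff p β e)
  coeff-D-mono zero    β e = trans (coeff-mono β e) (cong ℕtoℚ (sym (derivCoeff-zero β e)))
  coeff-D-mono (suc p) β e = begin
    coeff (D₁ (D p (mono β))) e
      ≡⟨ coeff-D₁ (D p (mono β)) e ⟩
    sum (λ i → ℕtoℚ (suc (lookup e i)) * coeff (D p (mono β)) (inc e i))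
      ≡⟨ sum-cong-≗ (λ i → trans (cong (ℕtoℚ (suc (lookup e i)) *_) (coeff-D-mono p β (inc e i)))
                                  (sym (ℕtoℚ-* (suc (lookup e i)) (derivCoeff p β (inc e i))))) ⟩
    sum (λ i → ℕtoℚ (suc (lookup e i) ℕ.* derivCoeff p β (inc e i)))
      ≡⟨ ℕtoℚ-sum (λ i → suc (lookup e i) ℕ.* derivCoeff p β (inc e i)) ⟨
    ℕtoℚ (ℕΣ.sum (λ i → suc (lookup e i) ℕ.* derivCoeff p β (inc e i)))
      ≡⟨ cong ℕtoℚ (derivCoeff-suc p β e) ⟩
    ℕtoℚ (derivCoeff (suc p) β e) ∎
    where open ≡-Reasoning

  termCoeff-+ᵛ : ∀ {k} c d (g h e : Mono k) →
                 termCoeff (c * d , g +ᵛ h) e ≡ (if does (g ≤ᵛ? e) then c * termCoeff (d , h) (e ∸ᵛ g) else 0ℚ)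
  termCoeff-+ᵛ c d g h e with g ≤ᵛ? e | (g +ᵛ h) ≟ᵛ e | h ≟ᵛ (e ∸ᵛ g)
  ... | yes _   | yes _     | yes _     = refl
  ... | yes _   | yes g+h≡e | no  h≢e∸g = ⊥-elim (h≢e∸g (m+ᵛn≡o⇒n≡o∸ᵛm g+h≡e))
  ... | yes g≤e | no  g+h≢e | yes h≡e∸g = ⊥-elim (g+h≢e (trans (cong (g +ᵛ_) h≡e∸g) (m+ᵛ[n∸ᵛm]≡n g≤e)))
  ... | yes _   | no  _     | no  _     = sym (*-zeroʳ c)
  ... | no  g≰e | yes g+h≡e | _         = ⊥-elim (g≰e (m+ᵛn≡o⇒m≤ᵛo g+h≡e))
  ... | no  _   | no  _     | _         = refl

  coeff-term-*P : ∀ {k} c (g : Mono k) Q e →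
                  coeff ([ (c , g) ] *P Q) e ≡ (if does (g ≤ᵛ? e) then c * coeff Q (e ∸ᵛ g) else 0ℚ)
  coeff-term-*P c g [] e with does (g ≤ᵛ? e)
  ... | true  = sym (*-zeroʳ c)
  ... | false = refl
  coeff-term-*P c g ((d , h) ∷ Q) e = begin
    coeff ((c * d , g +ᵛ h) ∷ ([ (c , g) ] *P Q)) e
      ≡⟨ coeff-∷ (c * d , g +ᵛ h) ([ (c , g) ] *P Q) e ⟩
    termCoeff (c * d , g +ᵛ h) e + coeff ([ (c , g) ] *P Q) e
      ≡⟨ cong₂ _+_ (termCoeff-+ᵛ c d g h e) (coeff-term-*P c g Q e) ⟩
    (if g≤e then c * termCoeff (d , h) (e ∸ᵛ g) else 0ℚ) + (if g≤e then c * coeff Q (e ∸ᵛ g) else 0ℚ)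
      ≡⟨ if-distrib g≤e ⟩
    (if g≤e then c * (termCoeff (d , h) (e ∸ᵛ g) + coeff Q (e ∸ᵛ g)) else 0ℚ)
      ≡⟨ cong (λ z → if g≤e then c * z else 0ℚ) (coeff-∷ (d , h) Q (e ∸ᵛ g)) ⟨
    (if g≤e then c * coeff ((d , h) ∷ Q) (e ∸ᵛ g) else 0ℚ) ∎
    where
    open ≡-Reasoning
    g≤e = does (g ≤ᵛ? e)
    if-distrib : ∀ b → (if b then c * termCoeff (d , h) (e ∸ᵛ g) else 0ℚ) + (if b then c * coeff Q (e ∸ᵛ g) else 0ℚ)
                       ≡ (if b then c * (termCoeff (d , h) (e ∸ᵛ g) + coeff Q (e ∸ᵛ g)) else 0ℚ)
    if-distrib true  = sym (*-distribˡ-+ c _ _)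
    if-distrib false = +-identityˡ 0ℚ

  ∑<-sift : ∀ n x (Z : ℕ → ℚ) → ∑[ b < suc n ] (if x ℕ.≡ᵇ b then Z b else 0ℚ) ≡ (if does (x ℕ.≤? n) then Z x else 0ℚ)
  ∑<-sift n       zero    Z = trans (cong (Z 0 +_) (∑<-zero n (λ _ → refl))) (+-identityʳ (Z 0))
  ∑<-sift zero    (suc x) Z = +-identityˡ 0ℚ
  ∑<-sift (suc n) (suc x) Z =
    trans (+-identityˡ _) (trans (∑<-sift n x (Z ∘ suc)) (cong (λ b → if b then Z (suc x) else 0ℚ) (≤ᵇ-suc x)))
    where
    ≤ᵇ-suc : ∀ x → (x ℕ.≤ᵇ n) ≡ (suc x ℕ.≤ᵇ suc n)
    ≤ᵇ-suc zero    = refl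
    ≤ᵇ-suc (suc x) = refl

  ∑-termCoeff-sift : ∀ {k} c (g e : Mono k) (X : Mono k → ℚ) →
                     ∑[ f ∈ below e ] (termCoeff (c , g) f * X f) ≡ (if does (g ≤ᵛ? e) then c * X g else 0ℚ)
  ∑-termCoeff-sift c []       []      X = +-identityʳ _
  ∑-termCoeff-sift c (g₀ ∷ g) (a ∷ e) X = begin
    ∑[ f ∈ below (a ∷ e) ] (termCoeff (c , g₀ ∷ g) f * X f)
      ≡⟨ ∑-below-∷ a e _ ⟩
    ∑[ b < suc a ] ∑[ f ∈ below e ] (termCoeff (c , g₀ ∷ g) (b ∷ f) * X (b ∷ f))
      ≡⟨ ∑<-cong (suc a) (λ b _ → slice b) ⟩
    ∑[ b < suc a ] (if g₀ ℕ.≡ᵇ b then Z b else 0ℚ)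
      ≡⟨ ∑<-sift a g₀ Z ⟩
    (if does (g₀ ℕ.≤? a) then Z g₀ else 0ℚ)
      ≡⟨ if-∧ (does (g₀ ℕ.≤? a)) ⟩
    (if does (g₀ ℕ.≤? a) ∧ does (g ≤ᵛ? e) then c * X (g₀ ∷ g) else 0ℚ) ∎
    where
    open ≡-Reasoning
    Z : ℕ → ℚ
    Z b = if does (g ≤ᵛ? e) then c * X (b ∷ g) else 0ℚ
    slice : ∀ b → ∑[ f ∈ below e ] (termCoeff (c , g₀ ∷ g) (b ∷ f) * X (b ∷ f)) ≡ (if g₀ ℕ.≡ᵇ b then Z b else 0ℚ)
    slice b with g₀ ℕ.≡ᵇ b
    ... | true  = ∑-termCoeff-sift c g e (λ f → X (b ∷ f))
    ... | false = ∑-zero (below e) (λ f → *-zeroˡ (X (b ∷ f)))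
    if-∧ : ∀ b → (if b then Z g₀ else 0ℚ) ≡ (if b ∧ does (g ≤ᵛ? e) then c * X (g₀ ∷ g) else 0ℚ)
    if-∧ true  = refl
    if-∧ false = refl

  coeff-*P : ∀ {k} (P Q : Poly k) e → coeff (P *P Q) e ≡ ∑[ f ∈ below e ] (coeff P f * coeff Q (e ∸ᵛ f))
  coeff-*P []            Q e = sym (∑-zero (below e) (λ f → *-zeroˡ (coeff Q (e ∸ᵛ f))))
  coeff-*P ((c , g) ∷ P) Q e = begin
    coeff (((c , g) ∷ P) *P Q) e
      ≡⟨ cong (λ R → coeff (R ++ (P *P Q)) e) (sym (++-identityʳ (List.map _ Q))) ⟩
    coeff (([ (c , g) ] *P Q) ++ (P *P Q)) e
      ≡⟨ coeff-++ ([ (c , g) ] *P Q) (P *P Q) e ⟩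
    coeff ([ (c , g) ] *P Q) e + coeff (P *P Q) e
      ≡⟨ cong₂ _+_ (trans (coeff-term-*P c g Q e) (sym (∑-termCoeff-sift c g e (λ f → coeff Q (e ∸ᵛ f))))) (coeff-*P P Q e) ⟩
    ∑[ f ∈ below e ] (termCoeff (c , g) f * coeff Q (e ∸ᵛ f)) + ∑[ f ∈ below e ] (coeff P f * coeff Q (e ∸ᵛ f))
      ≡⟨ ∑-distrib-+ (below e) _ _ ⟨
    ∑[ f ∈ below e ] (termCoeff (c , g) f * coeff Q (e ∸ᵛ f) + coeff P f * coeff Q (e ∸ᵛ f))
      ≡⟨ ∑-cong (below e) (λ f → trans (sym (*-distribʳ-+ (coeff Q (e ∸ᵛ f)) (termCoeff (c , g) f) (coeff P f)))
                                        (cong (_* coeff Q (e ∸ᵛ f)) (sym (coeff-∷ (c , g) P f)))) ⟩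
    ∑[ f ∈ below e ] (coeff ((c , g) ∷ P) f * coeff Q (e ∸ᵛ f)) ∎
    where open ≡-Reasoning

  coeff-LHS : ∀ {k} (α : Mono k) m p q e → coeff (LHS α m p q) e ≡ ℕtoℚ (lhsCoeff α m p q e)
  coeff-LHS α m p q e = begin
    coeff (LHS α m p q) e
      ≡⟨ coeff-sumP (List.map H (belowOfSize α m)) e ⟩
    ∑[ P ∈ List.map H (belowOfSize α m) ] coeff P e
      ≡⟨ ∑-map H (belowOfSize α m) (λ P → coeff P e) ⟩
    ∑[ β ∈ belowOfSize α m ] coeff (H β) e
      ≡⟨ ∑-cong (belowOfSize α m) coeff-H ⟩
    ∑[ β ∈ belowOfSize α m ] ℕtoℚ (G β)
      ≡⟨ ℕtoℚ-∑ (belowOfSize α m) G ⟨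
    ℕtoℚ (ℕΣ.∑ (belowOfSize α m) G) ∎
    where
    open ≡-Reasoning
    H : Mono _ → Poly _
    H β = scaleP (ℕtoℚ (multiBinom α β)) (D p (mono β) *P D q (mono (α ∸ᵛ β)))
    term : Mono _ → Mono _ → ℕ
    term β f = derivCoeff p β f ℕ.* derivCoeff q (α ∸ᵛ β) (e ∸ᵛ f)
    G : Mono _ → ℕ
    G β = multiBinom α β ℕ.* ℕΣ.∑ (below e) (term β)
    coeff-H : ∀ β → coeff (H β) e ≡ ℕtoℚ (G β)
    coeff-H β = begin
      coeff (H β) e
        ≡⟨ coeff-scaleP (ℕtoℚ (multiBinom α β)) (D p (mono β) *P D q (mono (α ∸ᵛ β))) e ⟩
      ℕtoℚ (multiBinom α β) * coeff (D p (mono β) *P D q (mono (α ∸ᵛ β))) e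
        ≡⟨ cong (ℕtoℚ (multiBinom α β) *_) (coeff-*P (D p (mono β)) (D q (mono (α ∸ᵛ β))) e) ⟩
      ℕtoℚ (multiBinom α β) * ∑[ f ∈ below e ] (coeff (D p (mono β)) f * coeff (D q (mono (α ∸ᵛ β))) (e ∸ᵛ f))
        ≡⟨ cong (ℕtoℚ (multiBinom α β) *_) (∑-cong (below e) (λ f →
             trans (cong₂ _*_ (coeff-D-mono p β f) (coeff-D-mono q (α ∸ᵛ β) (e ∸ᵛ f))) (sym (ℕtoℚ-* (derivCoeff p β f) _)))) ⟩
      ℕtoℚ (multiBinom α β) * ∑[ f ∈ below e ] ℕtoℚ (term β f)
        ≡⟨ cong (ℕtoℚ (multiBinom α β) *_) (ℕtoℚ-∑ (below e) (term β)) ⟨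
      ℕtoℚ (multiBinom α β) * ℕtoℚ (ℕΣ.∑ (below e) (term β))
        ≡⟨ ℕtoℚ-* (multiBinom α β) (ℕΣ.∑ (below e) (term β)) ⟨
      ℕtoℚ (G β) ∎

  coeff-RHS : ∀ {k} (α : Mono k) n m p q e → coeff (RHS α n m p q) e ≡ ℕtoℚ (rhsCoeff α n m p q e)
  coeff-RHS α n m p q e = begin
    coeff (RHS α n m p q) e                  ≡⟨ coeff-scaleP (ℕtoℚ B) (D (p ℕ.+ q) (mono α)) e ⟩
    ℕtoℚ B * coeff (D (p ℕ.+ q) (mono α)) e  ≡⟨ cong (ℕtoℚ B *_) (coeff-D-mono (p ℕ.+ q) α e) ⟩
    ℕtoℚ B * ℕtoℚ (derivCoeff (p ℕ.+ q) α e) ≡⟨ ℕtoℚ-* B (derivCoeff (p ℕ.+ q) α e) ⟨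
    ℕtoℚ (B ℕ.* derivCoeff (p ℕ.+ q) α e)    ∎
    where
    open ≡-Reasoning
    B = binomℤ (ℤ.+ n ℤ.- ℤ.+ p ℤ.- ℤ.+ q) (ℤ.+ m ℤ.- ℤ.+ p)

open Combinatorics
open IntegerBinomial
open Coefficients

lemma8 : (k : ℕ) (α : Vec ℕ k) (n m p q : ℕ) →
    ∣ α ∣ ≡ n → m ≤ n →
    LHS α m p q ≈P RHS α n m p q
lemma8 k α .(∣ α ∣) m p q refl _ e = begin
  coeff (LHS α m p q) e            ≡⟨ coeff-LHS α m p q e ⟩
  ℕtoℚ (lhsCoeff α m p q e)        ≡⟨ cong ℕtoℚ (lhsCoeff≡rhsCoeff α e m p q) ⟩
  ℕtoℚ (rhsCoeff α ∣ α ∣ m p q e)  ≡⟨ coeff-RHS α ∣ α ∣ m p q e ⟨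
  coeff (RHS α ∣ α ∣ m p q) e      ∎
  where open ≡-Reasoning
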